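{- Let $a_1,a_2\in\mathbb{Z}$ with $|a_1-a_2|=1$. For $m_1,m_2\in\mathbb{N}$ let \[ R(m_1,m_2)=\frac{1}{\phi(M)}\sum_{\substack{k=1\\ \gcd(k,M)=1}}^{M}\gcd(k-a_1,m_1)\gcd(k-a_2,m_2), \] where $M$ is any positive multiple of $\operatorname{lcm}[m_1,m_2]$. Then $R(m_1,m_2)$ equals the number of pairs $(d_1,d_2)$ with $d_1\mid m_1$, $d_2\mid m_2$, $\gcd(d_1,a_1)=1$, $\gcd(d_2,a_2)=1$ and $\gcd(d_1,d_2)=1$; and for every prime $p$ and all $u,v\in\mathbb{N}$, \[ R(p^u,p^v)=\begin{cases}u+v+1,& p\nmid a_1,\ p\nmid a_2,\\ u+1,& p\nmid a_1,\ p\mid a_2,\\ v+1,& p\mid a_1,\ p\nmid a_2,\\ 1,& p\mid a_1,\ p\mid a_2.\end{cases} \]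
   Context: $\mathbb{N}=\{1,2,\ldots\}$; $\phi$ is Euler's totient function. -}

module Defs where

open import Data.Nat using (ℕ; suc; _*_; _≟_)
open import Data.Nat.GCD using (gcd)
open import Data.Nat.Divisibility using (_∣?_)
open import Data.Nat.Coprimality using (Coprime; coprime?)
open import Data.Integer as ℤ using (ℤ; +_; ∣_∣)
open import Data.List using (List; map; filter; length; upTo; cartesianProduct)
open import Data.Nat.ListAction using (sum)
open import Data.Product using (_×_; _,_)
open import Relation.Nullary.Decidable using (_×-dec_)

range1 : ℕ → List ℕ
range1 n = map suc (upTo n)

φ : ℕ → ℕ
φ n = length (filter (λ k → gcd k n ≟ 1) (range1 n))

gcdℤ : ℤ → ℕ → ℕ
gcdℤ x m = gcd ∣ x ∣ m

-- Σ_{1 ≤ k ≤ M, gcd(k,M)=1} gcd(k - a₁, m₁) gcd(k - a₂, m₂)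
-- (so that R(m₁,m₂) = RSum a₁ a₂ m₁ m₂ M / φ M)
RSum : ℤ → ℤ → ℕ → ℕ → ℕ → ℕ
RSum a₁ a₂ m₁ m₂ M =
  sum (map (λ k → gcdℤ (+ k ℤ.- a₁) m₁ * gcdℤ (+ k ℤ.- a₂) m₂)
           (filter (λ k → gcd k M ≟ 1) (range1 M)))

-- positive divisors of m (for m ≥ 1)
divisors : ℕ → List ℕ
divisors m = filter (_∣? m) (range1 m)

pairCount : ℤ → ℤ → ℕ → ℕ → ℕ
pairCount a₁ a₂ m₁ m₂ =
  length (filter
    (λ { (d₁ , d₂) → coprime? d₁ ∣ a₁ ∣ ×-dec (coprime? d₂ ∣ a₂ ∣ ×-dec coprime? d₁ d₂) })
    (cartesianProduct (divisors m₁) (divisors m₂)))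

module Submission where

-- Writing k - aᵢ ≡ k + sᵢ (mod M) and expanding gcd(x, m) = Σ_{d ∣ m, d ∣ x} φ(d)
-- (Gauss), the sum becomes Σ_{d₁ ∣ m₁, d₂ ∣ m₂} φ(d₁)φ(d₂) · N(d₁, d₂), where N counts the
-- units k < M with k ≡ -s₁ (mod d₁) and k ≡ -s₂ (mod d₂).  A common factor of d₁ and d₂ would
-- divide a₁ - a₂ = ±1, and a unit in the classes forces (dᵢ, aᵢ) = 1, so N = 0 unless the
-- pair is admissible.  For admissible pairs, D = d₁d₂ divides M and the units modulo M are
-- spread evenly over the φ(D) units modulo D (uniformity, proved by adjoining the prime
-- factors of M / D one at a time); by the Chinese remainder theorem exactly one unit modulo D
-- lies in the two classes, so φ(D) · N = φ(M), and φ(D) = φ(d₁)φ(d₂).  For prime powers,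
-- two coprime divisors of p^u and p^v cannot both be proper, which gives the four values.

open import Data.Nat
open import Data.Nat.Properties
open import Data.Nat.Divisibility
open import Data.Nat.GCD
open import Data.Nat.DivMod
open import Data.Nat.LCM using (lcm; m∣lcm[m,n]; n∣lcm[m,n])
open import Data.Nat.Coprimality using (Coprime; coprime?; coprime-divisor; gcd≡1⇒coprime; coprime⇒gcd≡1)
import Data.Nat.Coprimality as Cop
open import Data.Nat.Primality using (Prime; prime⇒irreducible; prime⇒nonTrivial; euclidsLemma)
import Data.Nat.Primality.Factorisation as Fact
open import Data.Nat.ListAction using (sum; product)
open import Data.Nat.ListAction.Properties using (sum-++)
open import Data.Nat.Tactic.RingSolver using (solve-∀)
open import Data.Integer as ℤ using (ℤ)
import Data.Integer.Properties as ℤP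
import Data.Integer.Divisibility as ℤD
import Data.Integer.Divisibility.Signed as ℤS
open import Data.Integer.DivMod using (_%ℕ_; _/ℕ_; a≡a%ℕn+[a/ℕn]*n)
open import Data.Integer.Tactic.RingSolver renaming (solve-∀ to ℤ-solve-∀)
open import Data.Bool using (true; false; if_then_else_)
open import Data.List using (List; []; _∷_; map; filter; length; upTo; applyUpTo; cartesianProduct; _++_)
open import Data.List.Properties using (map-∘; map-++)
open import Data.List.Relation.Unary.All using (All; []; _∷_)
open import Data.Product using (_×_; _,_; proj₁; proj₂; ∃)
open import Data.Sum using (_⊎_; inj₁; inj₂)
open import Data.Empty using (⊥; ⊥-elim)
open import Relation.Nullary using (¬_; Dec; yes; no; does; contradiction)
open import Relation.Nullary.Decidable using (_×-dec_)
open import Relation.Unary using (Pred; Decidable)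
open import Relation.Binary.PropositionalEquality
open import Function using (_∘_; id; it)
import Algebra.Properties.CommutativeSemigroup
open import Defs

open ≡-Reasoning
module *-CS = Algebra.Properties.CommutativeSemigroup *-commutativeSemigroup

-- Finite sums Σ< n f = f 0 + f 1 + … + f (n ∸ 1) and their algebra.

Σ< : ℕ → (ℕ → ℕ) → ℕ
Σ< zero    f = 0
Σ< (suc n) f = f 0 + Σ< n (λ i → f (suc i))

Σ-cong : ∀ n {f g : ℕ → ℕ} → (∀ i → i < n → f i ≡ g i) → Σ< n f ≡ Σ< n g
Σ-cong zero    h = refl
Σ-cong (suc n) h = cong₂ _+_ (h 0 z<s) (Σ-cong n (λ i i<n → h (suc i) (s<s i<n)))

Σ-zero : ∀ n (f : ℕ → ℕ) → (∀ i → i < n → f i ≡ 0) → Σ< n f ≡ 0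
Σ-zero zero    f h = refl
Σ-zero (suc n) f h = cong₂ _+_ (h 0 z<s) (Σ-zero n _ (λ i i<n → h (suc i) (s<s i<n)))

Σ-const : ∀ n c → Σ< n (λ _ → c) ≡ n * c
Σ-const zero    c = refl
Σ-const (suc n) c = cong (c +_) (Σ-const n c)

Σ-+ : ∀ n (f g : ℕ → ℕ) → Σ< n (λ i → f i + g i) ≡ Σ< n f + Σ< n g
Σ-+ zero    f g = refl
Σ-+ (suc n) f g = trans (cong (f 0 + g 0 +_) (Σ-+ n (f ∘ suc) (g ∘ suc)))
                        (+-interchange (f 0) (g 0) _ _)
  where
  +-interchange : ∀ a b c d → (a + b) + (c + d) ≡ (a + c) + (b + d)
  +-interchange = solve-∀

Σ-*ˡ : ∀ n c (f : ℕ → ℕ) → c * Σ< n f ≡ Σ< n (λ i → c * f i)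
Σ-*ˡ zero    c f = *-zeroʳ c
Σ-*ˡ (suc n) c f = trans (*-distribˡ-+ c (f 0) _) (cong (c * f 0 +_) (Σ-*ˡ n c (f ∘ suc)))

Σ-*ʳ : ∀ n c (f : ℕ → ℕ) → Σ< n f * c ≡ Σ< n (λ i → f i * c)
Σ-*ʳ n c f = begin
  Σ< n f * c               ≡⟨ *-comm (Σ< n f) c ⟩
  c * Σ< n f               ≡⟨ Σ-*ˡ n c f ⟩
  Σ< n (λ i → c * f i)     ≡⟨ Σ-cong n (λ i _ → *-comm c (f i)) ⟩
  Σ< n (λ i → f i * c)     ∎

Σ-prod : ∀ m n (f g : ℕ → ℕ) → Σ< m f * Σ< n g ≡ Σ< m (λ i → Σ< n (λ j → f i * g j))
Σ-prod m n f g = trans (Σ-*ʳ m (Σ< n g) f) (Σ-cong m (λ i _ → Σ-*ˡ n (f i) g))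

Σ-swap : ∀ m n (f : ℕ → ℕ → ℕ) →
         Σ< m (λ i → Σ< n (λ j → f i j)) ≡ Σ< n (λ j → Σ< m (λ i → f i j))
Σ-swap zero    n f = sym (trans (Σ-const n 0) (*-zeroʳ n))
Σ-swap (suc m) n f = trans (cong (Σ< n (f 0) +_) (Σ-swap m n (f ∘ suc)))
                           (sym (Σ-+ n (f 0) (λ j → Σ< m (λ i → f (suc i) j))))

Σ-split : ∀ m n (f : ℕ → ℕ) → Σ< (m + n) f ≡ Σ< m f + Σ< n (λ i → f (m + i))
Σ-split zero    n f = refl
Σ-split (suc m) n f = trans (cong (f 0 +_) (Σ-split m n (f ∘ suc))) (sym (+-assoc (f 0) _ _))

Σ-block : ∀ q L (f : ℕ → ℕ) → Σ< (q * L) f ≡ Σ< q (λ t → Σ< L (λ c → f (t * L + c)))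
Σ-block zero    L f = refl
Σ-block (suc q) L f = trans (Σ-split L (q * L) f) (cong (Σ< L f +_) (trans
  (Σ-block q L (λ i → f (L + i)))
  (Σ-cong q (λ t _ → Σ-cong L (λ c _ → cong f (sym (+-assoc L (t * L) c)))))))

Σ-uncons : ∀ m (f : ℕ → ℕ) → 0 < m → Σ< m f ≡ f 0 + Σ< (m ∸ 1) (f ∘ suc)
Σ-uncons (suc m) f _ = refl

Σ-head : ∀ m (f : ℕ → ℕ) → 0 < m → (∀ r → suc r < m → f (suc r) ≡ 0) → Σ< m f ≡ f 0
Σ-head (suc m) f _ h = trans (cong (f 0 +_) (Σ-zero m _ (λ r r<m → h r (s<s r<m)))) (+-identityʳ (f 0))

Σ-extend : ∀ m n (f : ℕ → ℕ) → m ≤ n → (∀ i → m ≤ i → i < n → f i ≡ 0) → Σ< n f ≡ Σ< m f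
Σ-extend m n f m≤n h = begin
  Σ< n f                                   ≡⟨ cong (λ k → Σ< k f) (sym n≡m+d) ⟩
  Σ< (m + d) f                             ≡⟨ Σ-split m d f ⟩
  Σ< m f + Σ< d (λ i → f (m + i))          ≡⟨ cong (Σ< m f +_) (Σ-zero d _ tail) ⟩
  Σ< m f + 0                               ≡⟨ +-identityʳ _ ⟩
  Σ< m f                                   ∎
  where
  d : ℕ
  d = n ∸ m
  n≡m+d : m + d ≡ n
  n≡m+d = m+[n∸m]≡n m≤n
  tail : ∀ i → i < d → f (m + i) ≡ 0
  tail i i<d = h (m + i) (m≤m+n m i) (subst (m + i <_) n≡m+d (+-monoʳ-< m i<d))

Σ-rotate : ∀ n (f : ℕ → ℕ) → f n ≡ f 0 → Σ< n (f ∘ suc) ≡ Σ< n f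
Σ-rotate n f fn≡f0 = +-cancelˡ-≡ (f 0) _ _ (begin
  f 0 + Σ< n (f ∘ suc)   ≡⟨ Σ-snoc n f ⟩
  Σ< n f + f n           ≡⟨ cong (Σ< n f +_) fn≡f0 ⟩
  Σ< n f + f 0           ≡⟨ +-comm (Σ< n f) (f 0) ⟩
  f 0 + Σ< n f           ∎)
  where
  Σ-snoc : ∀ n (f : ℕ → ℕ) → Σ< (suc n) f ≡ Σ< n f + f n
  Σ-snoc zero    f = +-comm (f 0) 0
  Σ-snoc (suc n) f = trans (cong (f 0 +_) (Σ-snoc n (f ∘ suc))) (sym (+-assoc (f 0) _ _))

Σ-mono : ∀ n (f g : ℕ → ℕ) → (∀ i → i < n → f i ≤ g i) → Σ< n f ≤ Σ< n g
Σ-mono zero    f g h = z≤n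
Σ-mono (suc n) f g h = +-mono-≤ (h 0 z<s) (Σ-mono n _ _ (λ i i<n → h (suc i) (s<s i<n)))

term≤Σ : ∀ n (f : ℕ → ℕ) k → k < n → f k ≤ Σ< n f
term≤Σ (suc n) f zero    _         = m≤m+n (f 0) _
term≤Σ (suc n) f (suc k) (s<s k<n) = ≤-trans (term≤Σ n (f ∘ suc) k k<n) (m≤n+m _ (f 0))

Σ-bound : ∀ n (f : ℕ → ℕ) b → (∀ i → i < n → f i ≤ b) → Σ< n f ≤ n * b
Σ-bound n f b h = ≤-trans (Σ-mono n f (λ _ → b) h) (≤-reflexive (Σ-const n b))

Σ-saturated : ∀ n (g : ℕ → ℕ) b → (∀ i → i < n → g i ≤ b) → Σ< n g ≡ n * b →
              ∀ i → i < n → g i ≡ b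
Σ-saturated (suc n) g b g≤b total = every
  where
  tail≤ : Σ< n (g ∘ suc) ≤ n * b
  tail≤ = Σ-bound n _ b (λ i i<n → g≤b (suc i) (s<s i<n))
  head≡b : g 0 ≡ b
  head≡b = ≤-antisym (g≤b 0 z<s) (+-cancelʳ-≤ (n * b) b (g 0)
    (≤-trans (≤-reflexive (sym total)) (+-monoʳ-≤ (g 0) tail≤)))
  tail≡ : Σ< n (g ∘ suc) ≡ n * b
  tail≡ = +-cancelˡ-≡ b _ _ (trans (cong (_+ Σ< n (g ∘ suc)) (sym head≡b)) total)
  every : ∀ i → i < suc n → g i ≡ b
  every zero    _         = head≡b
  every (suc i) (s<s i<n) = Σ-saturated n (g ∘ suc) b (λ j j<n → g≤b (suc j) (s<s j<n)) tail≡ i i<n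

-- Indicators [P] ∈ {0, 1} of decidable propositions; counting is summing indicators.

𝟙 : ∀ {p} {P : Set p} → Dec P → ℕ
𝟙 d = if does d then 1 else 0

module _ {p} {P : Set p} where
  𝟙-yes : (d : Dec P) → P → 𝟙 d ≡ 1
  𝟙-yes (yes _) _  = refl
  𝟙-yes (no ¬p) x  = contradiction x ¬p

  𝟙-no : (d : Dec P) → ¬ P → 𝟙 d ≡ 0
  𝟙-no (yes x) ¬p = contradiction x ¬p
  𝟙-no (no _)  _  = refl

  𝟙≤1 : (d : Dec P) → 𝟙 d ≤ 1
  𝟙≤1 (yes _) = s≤s z≤n
  𝟙≤1 (no _)  = z≤n

module _ {p q} {P : Set p} {Q : Set q} where
  𝟙-× : (d : Dec P) (e : Dec Q) → 𝟙 (d ×-dec e) ≡ 𝟙 d * 𝟙 e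
  𝟙-× (yes _) (yes _) = refl
  𝟙-× (yes _) (no _)  = refl
  𝟙-× (no _)  _       = refl

  𝟙-⇔ : (P → Q) → (Q → P) → (d : Dec P) (e : Dec Q) → 𝟙 d ≡ 𝟙 e
  𝟙-⇔ f g (yes x) e = sym (𝟙-yes e (f x))
  𝟙-⇔ f g (no ¬x) e = sym (𝟙-no e (¬x ∘ g))

  𝟙-absorb : (P → Q) → (d : Dec P) (e : Dec Q) → 𝟙 e * 𝟙 d ≡ 𝟙 d
  𝟙-absorb f (yes x) e = trans (*-identityʳ (𝟙 e)) (𝟙-yes e (f x))
  𝟙-absorb f (no _)  e = *-zeroʳ (𝟙 e)

𝟙-⊎ : ∀ {p q r} {P : Set p} {Q : Set q} {R : Set r} →
      (P → Q ⊎ R) → (Q → P) → (R → P) → (Q → R → ⊥) →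
      (d : Dec P) (e : Dec Q) (f : Dec R) → 𝟙 d ≡ 𝟙 e + 𝟙 f
𝟙-⊎ split q⇒p r⇒p disjoint (yes x) (yes y) (yes z) = ⊥-elim (disjoint y z)
𝟙-⊎ split q⇒p r⇒p disjoint (yes x) (yes y) (no _)  = refl
𝟙-⊎ split q⇒p r⇒p disjoint (yes x) (no ¬y) (yes z) = refl
𝟙-⊎ split q⇒p r⇒p disjoint (yes x) (no ¬y) (no ¬z) with split x
... | inj₁ y = contradiction y ¬y
... | inj₂ z = contradiction z ¬z
𝟙-⊎ split q⇒p r⇒p disjoint (no ¬x) (yes y) _       = contradiction (q⇒p y) ¬x
𝟙-⊎ split q⇒p r⇒p disjoint (no ¬x) (no _)  (yes z) = contradiction (r⇒p z) ¬x
𝟙-⊎ split q⇒p r⇒p disjoint (no ¬x) (no _)  (no _)  = refl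

count≤1 : ∀ {p} {P : ℕ → Set p} (P? : Decidable P) n →
          (∀ i j → i < n → j < n → P i → P j → i ≡ j) → Σ< n (λ i → 𝟙 (P? i)) ≤ 1
count≤1 P? zero    uniq = z≤n
count≤1 P? (suc n) uniq with P? 0
... | yes p0 = ≤-reflexive (cong suc (Σ-zero n _ (λ i i<n → 𝟙-no (P? (suc i))
                 (λ pi → 0≢1+n (sym (uniq (suc i) 0 (s<s i<n) z<s pi p0))))))
... | no _   = count≤1 (P? ∘ suc) n (λ i j i<n j<n pi pj →
                 suc-injective (uniq (suc i) (suc j) (s<s i<n) (s<s j<n) pi pj))

count≡1 : ∀ {p} {P : ℕ → Set p} (P? : Decidable P) n →
          (∀ i j → i < n → j < n → P i → P j → i ≡ j) →
          ∀ k → k < n → P k → Σ< n (λ i → 𝟙 (P? i)) ≡ 1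
count≡1 P? n uniq k k<n pk = ≤-antisym (count≤1 P? n uniq)
  (≤-trans (≤-reflexive (sym (𝟙-yes (P? k) pk))) (term≤Σ n _ k k<n))

-- The definitions count with filtered lists; these lemmas turn such counts into finite sums.

module _ {a p} {A : Set a} {P : Pred A p} (P? : Decidable P) where
  sum-filter : (h : A → ℕ) (xs : List A) →
               sum (map h (filter P? xs)) ≡ sum (map (λ x → 𝟙 (P? x) * h x) xs)
  sum-filter h []       = refl
  sum-filter h (x ∷ xs) with does (P? x)
  ... | true  = cong₂ _+_ (sym (+-identityʳ (h x))) (sum-filter h xs)
  ... | false = sum-filter h xs

  length-filter : (xs : List A) → length (filter P? xs) ≡ sum (map (λ x → 𝟙 (P? x)) xs)
  length-filter []       = refl
  length-filter (x ∷ xs) with does (P? x)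
  ... | true  = cong suc (length-filter xs)
  ... | false = length-filter xs

sum-range1 : (h : ℕ → ℕ) (n : ℕ) → sum (map h (range1 n)) ≡ Σ< n (h ∘ suc)
sum-range1 h n = trans (cong sum (sym (map-∘ (upTo n)))) (sum-applyUpTo (h ∘ suc) id n)
  where
  sum-applyUpTo : ∀ (h g : ℕ → ℕ) n → sum (map h (applyUpTo g n)) ≡ Σ< n (h ∘ g)
  sum-applyUpTo h g zero    = refl
  sum-applyUpTo h g (suc n) = cong (h (g 0) +_) (sum-applyUpTo h (g ∘ suc) n)

sum-cartesianProduct : ∀ {a b} {A : Set a} {B : Set b} (h : A × B → ℕ) (xs : List A) (ys : List B) →
  sum (map h (cartesianProduct xs ys)) ≡ sum (map (λ x → sum (map (λ y → h (x , y)) ys)) xs)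
sum-cartesianProduct h []       ys = refl
sum-cartesianProduct h (x ∷ xs) ys = begin
  sum (map h (map (x ,_) ys ++ cartesianProduct xs ys))
    ≡⟨ cong sum (map-++ h (map (x ,_) ys) _) ⟩
  sum (map h (map (x ,_) ys) ++ map h (cartesianProduct xs ys))
    ≡⟨ sum-++ (map h (map (x ,_) ys)) _ ⟩
  sum (map h (map (x ,_) ys)) + sum (map h (cartesianProduct xs ys))
    ≡⟨ cong₂ _+_ (cong sum (sym (map-∘ ys))) (sum-cartesianProduct h xs ys) ⟩
  sum (map (λ y → h (x , y)) ys) + sum (map (λ x → sum (map (λ y → h (x , y)) ys)) xs)
    ∎

-- Residues modulo d.

∣<⇒≡0 : ∀ {d m} → d ∣ m → m < d → m ≡ 0
∣<⇒≡0 {m = zero}  _   _   = refl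
∣<⇒≡0 {m = suc m} d∣m m<d = contradiction (∣⇒≤ d∣m) (<⇒≱ m<d)

∣∸<⇒≡ : ∀ {d i j} → i ≤ j → j < d → d ∣ j ∸ i → i ≡ j
∣∸<⇒≡ {i = i} {j} i≤j j<d d∣ = ≤-antisym i≤j (m∸n≡0⇒m≤n (∣<⇒≡0 d∣ (≤-<-trans (m∸n≤m j i) j<d)))

unique-by-≤ : ∀ {p} {P : ℕ → Set p} → (∀ {i j} → i ≤ j → P i → P j → i ≡ j) →
              ∀ {i j} → P i → P j → i ≡ j
unique-by-≤ h {i} {j} pi pj with ≤-total i j
... | inj₁ i≤j = h i≤j pi pj
... | inj₂ j≤i = sym (h j≤i pj pi)

∣-diff : ∀ {d a b c} → d ∣ a + c → d ∣ b + c → a ≤ b → d ∣ b ∸ a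
∣-diff {d} {a} {b} {c} da db a≤b = ∣m+n∣m⇒∣n (subst (d ∣_) b+c≡a+c+[b∸a] db) da
  where
  b+c≡a+c+[b∸a] : b + c ≡ (a + c) + (b ∸ a)
  b+c≡a+c+[b∸a] = trans (cong (_+ c) (sym (m+[n∸m]≡n a≤b))) (swap a (b ∸ a) c)
    where
    swap : ∀ x y z → (x + y) + z ≡ (x + z) + y
    swap = solve-∀

∣-shift : ∀ {d x y} → d ∣ x → (d ∣ x + y → d ∣ y) × (d ∣ y → d ∣ x + y)
∣-shift d∣x = (λ h → ∣m+n∣m⇒∣n h d∣x) , ∣m∣n⇒∣m+n d∣x

coprime-∣⇒*∣ : ∀ {a b x} → Coprime a b → a ∣ x → b ∣ x → a * b ∣ x
coprime-∣⇒*∣ {a} {b} c (divides q refl) b∣qa =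
  subst (a * b ∣_) (*-comm a q) (*-monoʳ-∣ a (coprime-divisor (Cop.sym c) (subst (b ∣_) (*-comm q a) b∣qa)))

-- The indicator δ d c k = [d ∣ k + c], i.e. [k ≡ -c (mod d)].
δ : ℕ → ℕ → ℕ → ℕ
δ d c k = 𝟙 (d ∣? (k + c))

δ-mod : ∀ d .{{_ : NonZero d}} c k → δ d c k ≡ δ d (c % d) k
δ-mod d c k = 𝟙-⇔ (proj₁ (∣-shift′ (n∣m*n (c / d)))) (proj₂ (∣-shift′ (n∣m*n (c / d))))
                  (d ∣? (k + c)) (d ∣? (k + c % d))
  where
  k+c≡ : k + c ≡ c / d * d + (k + c % d)
  k+c≡ = trans (cong (k +_) (trans (m≡m%n+[m/n]*n c d) (+-comm (c % d) _))) (+-comm-assoc k (c / d * d) (c % d))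
    where
    +-comm-assoc : ∀ x y z → x + (y + z) ≡ y + (x + z)
    +-comm-assoc = solve-∀
  ∣-shift′ : d ∣ c / d * d → (d ∣ k + c → d ∣ k + c % d) × (d ∣ k + c % d → d ∣ k + c)
  ∣-shift′ d∣ = (λ h → proj₁ (∣-shift d∣) (subst (d ∣_) k+c≡ h))
              , (λ h → subst (d ∣_) (sym k+c≡) (proj₂ (∣-shift d∣) h))

complement-exists : ∀ d → 0 < d → ∀ k → ∃ λ c → c < d × d ∣ k + c
complement-exists d d>0 zero = 0 , d>0 , (d ∣0)
complement-exists d d>0 (suc k) with complement-exists d d>0 k
... | suc c , c<d , h = c , <-trans (n<1+n c) c<d , subst (d ∣_) (+-suc k c) h
... | zero  , _   , h = d ∸ 1 , ∸-monoʳ-< z<s d>0 , subst (d ∣_) k+d≡ (∣m∣n⇒∣m+n (subst (d ∣_) (+-identityʳ k) h) ∣-refl)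
  where
  k+d≡ : k + d ≡ suc k + (d ∸ 1)
  k+d≡ = trans (cong (k +_) (sym (m+[n∸m]≡n {1} {d} d>0))) (+-suc k (d ∸ 1))

δ-partition : ∀ d → 0 < d → ∀ k → Σ< d (λ c → δ d c k) ≡ 1
δ-partition d d>0 k with complement-exists d d>0 k
... | c , c<d , d∣ = count≡1 (λ c → d ∣? (k + c)) d
  (λ i j i<d j<d hi hj → unique-by-≤ {P = λ c → c < d × d ∣ k + c}
     (λ i≤j (_ , hi) (j<d , hj) → ∣∸<⇒≡ i≤j j<d (∣-diff (comm hi) (comm hj) i≤j)) (i<d , hi) (j<d , hj))
  c c<d d∣
  where
  comm : ∀ {x} → d ∣ k + x → d ∣ x + k
  comm {x} = subst (d ∣_) (+-comm k x)

-- At most one, because a difference of two solutions is divisible by d₁d₂;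
-- at least one, because the d₁d₂ counts are ≤ 1 and add up to d₁d₂.
crt-count : ∀ d₁ d₂ .{{_ : NonZero d₁}} .{{_ : NonZero d₂}} → Coprime d₁ d₂ →
            ∀ c₁ c₂ → Σ< (d₁ * d₂) (λ k → δ d₁ c₁ k * δ d₂ c₂ k) ≡ 1
crt-count d₁ d₂ cop c₁ c₂ = begin
  Σ< D (λ k → δ d₁ c₁ k * δ d₂ c₂ k)
    ≡⟨ Σ-cong D (λ k _ → cong₂ _*_ (δ-mod d₁ c₁ k) (δ-mod d₂ c₂ k)) ⟩
  T (c₁ % d₁) (c₂ % d₂)
    ≡⟨ T≡1-reduced (c₁ % d₁) (c₂ % d₂) (m%n<n c₁ d₁) (m%n<n c₂ d₂) ⟩
  1 ∎
  where
  D : ℕ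
  D = d₁ * d₂

  T : ℕ → ℕ → ℕ
  T c₁ c₂ = Σ< D (λ k → δ d₁ c₁ k * δ d₂ c₂ k)

  T≤1 : ∀ c₁ c₂ → T c₁ c₂ ≤ 1
  T≤1 c₁ c₂ = ≤-trans
    (≤-reflexive (Σ-cong D (λ k _ → sym (𝟙-× (d₁ ∣? (k + c₁)) (d₂ ∣? (k + c₂))))))
    (count≤1 (λ k → (d₁ ∣? (k + c₁)) ×-dec (d₂ ∣? (k + c₂))) D
      (λ i j i<D j<D hi hj → unique-by-≤ {P = λ k → k < D × d₁ ∣ k + c₁ × d₂ ∣ k + c₂}
        (λ i≤j (_ , a₁ , a₂) (j<D , b₁ , b₂) → ∣∸<⇒≡ i≤j j<D
          (coprime-∣⇒*∣ cop (∣-diff a₁ b₁ i≤j) (∣-diff a₂ b₂ i≤j)))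
        (i<D , hi) (j<D , hj)))

  -- Each k < D lies in exactly one pair of residue classes.
  total : Σ< d₁ (λ c₁ → Σ< d₂ (T c₁)) ≡ D
  total = begin
    Σ< d₁ (λ c₁ → Σ< d₂ (λ c₂ → Σ< D (λ k → δ d₁ c₁ k * δ d₂ c₂ k)))
      ≡⟨ Σ-cong d₁ (λ c₁ _ → Σ-swap d₂ D _) ⟩
    Σ< d₁ (λ c₁ → Σ< D (λ k → Σ< d₂ (λ c₂ → δ d₁ c₁ k * δ d₂ c₂ k)))
      ≡⟨ Σ-swap d₁ D _ ⟩
    Σ< D (λ k → Σ< d₁ (λ c₁ → Σ< d₂ (λ c₂ → δ d₁ c₁ k * δ d₂ c₂ k)))
      ≡⟨ Σ-cong D (λ k _ → sym (Σ-prod d₁ d₂ (λ c₁ → δ d₁ c₁ k) (λ c₂ → δ d₂ c₂ k))) ⟩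
    Σ< D (λ k → Σ< d₁ (λ c₁ → δ d₁ c₁ k) * Σ< d₂ (λ c₂ → δ d₂ c₂ k))
      ≡⟨ Σ-cong D (λ k _ → cong₂ _*_ (δ-partition d₁ (>-nonZero⁻¹ d₁) k) (δ-partition d₂ (>-nonZero⁻¹ d₂) k)) ⟩
    Σ< D (λ _ → 1)
      ≡⟨ trans (Σ-const D 1) (*-identityʳ D) ⟩
    D ∎

  T≡1-reduced : ∀ c₁ c₂ → c₁ < d₁ → c₂ < d₂ → T c₁ c₂ ≡ 1
  T≡1-reduced c₁ c₂ c₁<d₁ c₂<d₂ =
    Σ-saturated d₂ (T c₁) 1 (λ c₂ _ → T≤1 c₁ c₂) (trans row≡d₂ (sym (*-identityʳ d₂))) c₂ c₂<d₂
    where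
    row≤d₂ : ∀ c₁ → c₁ < d₁ → Σ< d₂ (T c₁) ≤ d₂
    row≤d₂ c₁ _ = ≤-trans (Σ-bound d₂ (T c₁) 1 (λ c₂ _ → T≤1 c₁ c₂)) (≤-reflexive (*-identityʳ d₂))
    row≡d₂ : Σ< d₂ (T c₁) ≡ d₂
    row≡d₂ = Σ-saturated d₁ (λ c₁ → Σ< d₂ (T c₁)) d₂ row≤d₂ total c₁ c₁<d₁

-- Coprimality (the library's Coprime m n: every common divisor of m and n is 1).

prime>1 : ∀ {q} → Prime q → 1 < q
prime>1 {q} q-prime = nonTrivial⇒n>1 q {{prime⇒nonTrivial q-prime}}

coprime-transfer : ∀ {x y n} → (∀ {e} → e ∣ n → e ∣ x → e ∣ y) → Coprime y n → Coprime x n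
coprime-transfer h c (e∣x , e∣n) = c (h e∣n e∣x , e∣n)

coprime-shift : ∀ {n m x} → n ∣ m → (Coprime (m + x) n → Coprime x n) × (Coprime x n → Coprime (m + x) n)
coprime-shift n∣m = coprime-transfer (λ e∣n e∣x → ∣m∣n⇒∣m+n (∣-trans e∣n n∣m) e∣x)
                  , coprime-transfer (λ e∣n e∣mx → ∣m+n∣m⇒∣n e∣mx (∣-trans e∣n n∣m))

coprime-*⇒ : ∀ {x a b} → Coprime x (a * b) → Coprime x a × Coprime x b
coprime-*⇒ {a = a} {b} c = (λ (e∣x , e∣a) → c (e∣x , ∣m⇒∣m*n b e∣a))
                         , (λ (e∣x , e∣b) → c (e∣x , ∣n⇒∣m*n a e∣b))

coprime-*⇐ : ∀ {x a b} → Coprime x a → Coprime x b → Coprime x (a * b)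
coprime-*⇐ ca cb {d} (d∣x , d∣ab) = cb (d∣x , coprime-divisor d⊥a d∣ab)
  where
  d⊥a : Coprime d _
  d⊥a (e∣d , e∣a) = ca (∣-trans e∣d d∣x , e∣a)

coprime-prime⇒ : ∀ {x q} → Prime q → Coprime x q → ¬ q ∣ x
coprime-prime⇒ q-prime c q∣x = <⇒≢ (prime>1 q-prime) (sym (c (q∣x , ∣-refl)))

coprime-prime⇐ : ∀ {x q} → Prime q → ¬ q ∣ x → Coprime x q
coprime-prime⇐ q-prime q∤x (d∣x , d∣q) with prime⇒irreducible q-prime d∣q
... | inj₁ d≡1 = d≡1
... | inj₂ refl = contradiction d∣x q∤x

U : ℕ → ℕ → ℕ
U n x = 𝟙 (gcd x n ≟ 1)

totient : ℕ → ℕ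
totient n = Σ< n (U n)

toCop : ∀ {x n} → gcd x n ≡ 1 → Coprime x n
toCop {x} {n} = gcd≡1⇒coprime {x} {n}

toGcd : ∀ {x n} → Coprime x n → gcd x n ≡ 1
toGcd {x} {n} = coprime⇒gcd≡1 {x} {n}

U-⇔ : ∀ {n m x y} → (Coprime x n → Coprime y m) → (Coprime y m → Coprime x n) → U n x ≡ U m y
U-⇔ {n} {m} {x} {y} f g = 𝟙-⇔ (λ e → toGcd (f (toCop e))) (λ e → toGcd (g (toCop e)))
                              (gcd x n ≟ 1) (gcd y m ≟ 1)

U-yes : ∀ {n x} → Coprime x n → U n x ≡ 1
U-yes {n} {x} c = 𝟙-yes (gcd x n ≟ 1) (toGcd c)

U-absorb : ∀ {p} {P : Set p} {n x} → (P → Coprime x n) → (d : Dec P) → U n x * 𝟙 d ≡ 𝟙 d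
U-absorb {n = n} {x} f d = 𝟙-absorb (toGcd ∘ f) d (gcd x n ≟ 1)

U-* : ∀ a b x → U (a * b) x ≡ U a x * U b x
U-* a b x = trans
  (𝟙-⇔ (λ e → let (ca , cb) = coprime-*⇒ {x} {a} {b} (toCop e) in toGcd ca , toGcd cb)
       (λ (ea , eb) → toGcd (coprime-*⇐ {x} {a} {b} (toCop ea) (toCop eb)))
       (gcd x (a * b) ≟ 1) ((gcd x a ≟ 1) ×-dec (gcd x b ≟ 1)))
  (𝟙-× (gcd x a ≟ 1) (gcd x b ≟ 1))

coprime-complement : ∀ {d k c} → d ∣ k + c → Coprime c d → Coprime k d
coprime-complement {d} {k} {c} d∣ = coprime-transfer {k} {c} {d} (λ e∣d e∣k → ∣m+n∣m⇒∣n (∣-trans e∣d d∣) e∣k)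

U-res : ∀ d k c → d ∣ k + c → U d k ≡ U d c
U-res d k c d∣ = U-⇔ {d} {d} {k} {c} (coprime-complement (subst (d ∣_) (+-comm k c) d∣)) (coprime-complement d∣)

U-period : ∀ n → U n n ≡ U n 0
U-period n = U-res n n 0 (subst (n ∣_) (sym (+-identityʳ n)) ∣-refl)

U-expand : ∀ d → 0 < d → ∀ k → U d k ≡ Σ< d (λ c → δ d c k * U d c)
U-expand d d>0 k = begin
  U d k                                 ≡⟨ sym (*-identityʳ (U d k)) ⟩
  U d k * 1                             ≡⟨ cong (U d k *_) (sym (δ-partition d d>0 k)) ⟩
  U d k * Σ< d (λ c → δ d c k)          ≡⟨ Σ-*ˡ d (U d k) _ ⟩
  Σ< d (λ c → U d k * δ d c k)          ≡⟨ Σ-cong d (λ c _ → residue c (d ∣? (k + c))) ⟩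
  Σ< d (λ c → δ d c k * U d c)          ∎
  where
  residue : ∀ c (dec : Dec (d ∣ k + c)) → U d k * 𝟙 dec ≡ 𝟙 dec * U d c
  residue c (yes d∣) = trans (*-identityʳ (U d k)) (trans (U-res d k c d∣) (sym (+-identityʳ (U d c))))
  residue c (no _)   = *-zeroʳ (U d k)

-- The totient is multiplicative: expand both unit indicators along residues and count
-- the k with prescribed residues by the Chinese remainder theorem.
totient-* : ∀ d₁ d₂ .{{_ : NonZero d₁}} .{{_ : NonZero d₂}} → Coprime d₁ d₂ →
            totient (d₁ * d₂) ≡ totient d₁ * totient d₂
totient-* d₁ d₂ cop = begin
  Σ< D (U D)
    ≡⟨ Σ-cong D (λ k _ → trans (U-* d₁ d₂ k) (expand k)) ⟩
  Σ< D (λ k → Σ< d₁ (λ c₁ → Σ< d₂ (λ c₂ → (δ d₁ c₁ k * U d₁ c₁) * (δ d₂ c₂ k * U d₂ c₂))))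
    ≡⟨ Σ-swap D d₁ _ ⟩
  Σ< d₁ (λ c₁ → Σ< D (λ k → Σ< d₂ (λ c₂ → (δ d₁ c₁ k * U d₁ c₁) * (δ d₂ c₂ k * U d₂ c₂))))
    ≡⟨ Σ-cong d₁ (λ c₁ _ → trans (Σ-swap D d₂ _) (Σ-cong d₂ (λ c₂ _ → residue-pair c₁ c₂))) ⟩
  Σ< d₁ (λ c₁ → Σ< d₂ (λ c₂ → U d₁ c₁ * U d₂ c₂))
    ≡⟨ sym (Σ-prod d₁ d₂ (U d₁) (U d₂)) ⟩
  Σ< d₁ (U d₁) * Σ< d₂ (U d₂) ∎
  where
  D : ℕ
  D = d₁ * d₂
  expand : ∀ k → U d₁ k * U d₂ k ≡
           Σ< d₁ (λ c₁ → Σ< d₂ (λ c₂ → (δ d₁ c₁ k * U d₁ c₁) * (δ d₂ c₂ k * U d₂ c₂)))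
  expand k = trans (cong₂ _*_ (U-expand d₁ (>-nonZero⁻¹ d₁) k) (U-expand d₂ (>-nonZero⁻¹ d₂) k))
                   (Σ-prod d₁ d₂ _ _)
  regroup : ∀ a u b v → (a * u) * (b * v) ≡ (u * v) * (a * b)
  regroup = solve-∀
  residue-pair : ∀ c₁ c₂ → Σ< D (λ k → (δ d₁ c₁ k * U d₁ c₁) * (δ d₂ c₂ k * U d₂ c₂)) ≡ U d₁ c₁ * U d₂ c₂
  residue-pair c₁ c₂ = begin
    Σ< D (λ k → (δ d₁ c₁ k * U d₁ c₁) * (δ d₂ c₂ k * U d₂ c₂))
      ≡⟨ Σ-cong D (λ k _ → regroup (δ d₁ c₁ k) (U d₁ c₁) (δ d₂ c₂ k) (U d₂ c₂)) ⟩
    Σ< D (λ k → (U d₁ c₁ * U d₂ c₂) * (δ d₁ c₁ k * δ d₂ c₂ k))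
      ≡⟨ sym (Σ-*ˡ D (U d₁ c₁ * U d₂ c₂) _) ⟩
    (U d₁ c₁ * U d₂ c₂) * Σ< D (λ k → δ d₁ c₁ k * δ d₂ c₂ k)
      ≡⟨ cong (U d₁ c₁ * U d₂ c₂ *_) (crt-count d₁ d₂ cop c₁ c₂) ⟩
    (U d₁ c₁ * U d₂ c₂) * 1
      ≡⟨ *-identityʳ _ ⟩
    U d₁ c₁ * U d₂ c₂ ∎

-- Uniformity of units: weighted sums over the units modulo M of a periodic weight.

Periodic : ℕ → (ℕ → ℕ) → Set
Periodic L f = ∀ k → f (L + k) ≡ f k

periodic-multiple : ∀ {L f} → Periodic L f → ∀ t c → f (t * L + c) ≡ f c
periodic-multiple per zero    c = refl
periodic-multiple {L} {f} per (suc t) c =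
  trans (cong f (+-assoc L (t * L) c)) (trans (per (t * L + c)) (periodic-multiple per t c))

unitSum : ℕ → (ℕ → ℕ) → ℕ
unitSum n f = Σ< n (λ k → U n k * f k)

totient≡unitSum : ∀ n → totient n ≡ unitSum n (λ _ → 1)
totient≡unitSum n = Σ-cong n (λ k _ → sym (*-identityʳ (U n k)))

module PrimeLift (q L : ℕ) (q-prime : Prime q) where
  private
    q>0 : 0 < q
    q>0 = <-trans z<s (prime>1 q-prime)
    instance
      q≢0 : NonZero q
      q≢0 = >-nonZero q>0

  liftFactor : ℕ
  liftFactor with q ∣? L
  ... | yes _ = q
  ... | no _  = q ∸ 1

  liftFactor>0 : 0 < liftFactor
  liftFactor>0 with q ∣? L
  ... | yes _ = q>0
  ... | no _  = m<n⇒0<n∸m (prime>1 q-prime)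

  -- If q ∤ L, then t ↦ tL permutes the residues modulo q, so exactly one t < q
  -- satisfies q ∣ tL + c.
  hits-once : ¬ q ∣ L → ∀ c → Σ< q (λ t → δ q c (t * L)) ≡ 1
  hits-once q∤L c = trans (Σ-cong q (λ t _ → δ-mod q c (t * L)))
    (Σ-saturated q V 1 V≤1 total (c % q) (m%n<n c q))
    where
    V : ℕ → ℕ
    V c = Σ< q (λ t → δ q c (t * L))

    same-t : ∀ {c i j} → i ≤ j → j < q → q ∣ i * L + c → q ∣ j * L + c → i ≡ j
    same-t {i = i} {j} i≤j j<q hi hj with euclidsLemma (j ∸ i) L q-prime
      (subst (q ∣_) (sym (*-distribʳ-∸ L j i)) (∣-diff hi hj (*-monoˡ-≤ L i≤j)))
    ... | inj₁ q∣j∸i = ∣∸<⇒≡ i≤j j<q q∣j∸i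
    ... | inj₂ q∣L   = contradiction q∣L q∤L

    V≤1 : ∀ c → c < q → V c ≤ 1
    V≤1 c _ = count≤1 (λ t → q ∣? (t * L + c)) q
      (λ i j i<q j<q hi hj → unique-by-≤ {P = λ t → t < q × q ∣ t * L + c}
        (λ i≤j (_ , hi) (j<q , hj) → same-t i≤j j<q hi hj) (i<q , hi) (j<q , hj))

    total : Σ< q V ≡ q * 1
    total = begin
      Σ< q (λ c → Σ< q (λ t → δ q c (t * L)))   ≡⟨ Σ-swap q q _ ⟩
      Σ< q (λ t → Σ< q (λ c → δ q c (t * L)))   ≡⟨ Σ-cong q (λ t _ → δ-partition q q>0 (t * L)) ⟩
      Σ< q (λ _ → 1)                             ≡⟨ Σ-const q 1 ⟩
      q * 1                                      ∎

  U-prime : ∀ x → U q x ≡ 1 ∸ 𝟙 (q ∣? x)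
  U-prime x with q ∣? x
  ... | yes q∣x = 𝟙-no (gcd x q ≟ 1) (λ e → coprime-prime⇒ q-prime (toCop e) q∣x)
  ... | no q∤x  = U-yes (coprime-prime⇐ q-prime q∤x)

  U-translate : ∀ t c → U L (t * L + c) ≡ U L c
  U-translate t c = U-⇔ (proj₁ (coprime-shift (n∣m*n t))) (proj₂ (coprime-shift (n∣m*n t)))

  fibre : ∀ c → Σ< q (λ t → U (q * L) (t * L + c)) ≡ liftFactor * U L c
  fibre c with q ∣? L
  ... | yes q∣L = begin
    Σ< q (λ t → U (q * L) (t * L + c))           ≡⟨ Σ-cong q (λ t _ → trans (U-* q L (t * L + c)) (term t)) ⟩
    Σ< q (λ _ → U L c)                           ≡⟨ Σ-const q (U L c) ⟩
    q * U L c                                    ∎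
    where
    -- a unit c modulo L is prime to q ∣ L, hence so is t·L + c
    term : ∀ t → U q (t * L + c) * U L (t * L + c) ≡ U L c
    term t = trans (cong (U q (t * L + c) *_) (U-translate t c))
      (U-absorb (λ e → coprime-prime⇐ q-prime (λ q∣ →
          coprime-prime⇒ q-prime (λ (e∣c , e∣q) → toCop e (e∣c , ∣-trans e∣q q∣L))
                                 (∣m+n∣m⇒∣n q∣ (∣n⇒∣m*n t q∣L))))
        (gcd c L ≟ 1))
  ... | no q∤L = begin
    Σ< q (λ t → U (q * L) (t * L + c))           ≡⟨ Σ-cong q (λ t _ → term t) ⟩
    Σ< q (λ t → U L c * (1 ∸ δ q c (t * L)))     ≡⟨ sym (Σ-*ˡ q (U L c) _) ⟩
    U L c * Σ< q (λ t → 1 ∸ δ q c (t * L))       ≡⟨ cong (U L c *_) non-hits ⟩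
    U L c * (q ∸ 1)                              ≡⟨ *-comm (U L c) (q ∸ 1) ⟩
    (q ∸ 1) * U L c                              ∎
    where
    term : ∀ t → U (q * L) (t * L + c) ≡ U L c * (1 ∸ δ q c (t * L))
    term t = trans (U-* q L (t * L + c)) (trans (cong₂ _*_ (U-prime (t * L + c)) (U-translate t c)) (*-comm _ (U L c)))
    non-hits : Σ< q (λ t → 1 ∸ δ q c (t * L)) ≡ q ∸ 1
    non-hits = begin
      Σ< q (λ t → 1 ∸ δ q c (t * L))                                  ≡⟨ sym (m+n∸n≡m _ 1) ⟩
      Σ< q (λ t → 1 ∸ δ q c (t * L)) + 1 ∸ 1                          ≡⟨ cong (λ x → Σ< q (λ t → 1 ∸ δ q c (t * L)) + x ∸ 1) (sym (hits-once q∤L c)) ⟩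
      Σ< q (λ t → 1 ∸ δ q c (t * L)) + Σ< q (λ t → δ q c (t * L)) ∸ 1 ≡⟨ cong (_∸ 1) (sym (Σ-+ q _ _)) ⟩
      Σ< q (λ t → (1 ∸ δ q c (t * L)) + δ q c (t * L)) ∸ 1            ≡⟨ cong (_∸ 1) (Σ-cong q (λ t _ → m∸n+n≡m (𝟙≤1 (q ∣? (t * L + c))))) ⟩
      Σ< q (λ _ → 1) ∸ 1                                              ≡⟨ cong (_∸ 1) (trans (Σ-const q 1) (*-identityʳ q)) ⟩
      q ∸ 1                                                           ∎

  unitSum-lift : ∀ f → Periodic L f → unitSum (q * L) f ≡ liftFactor * unitSum L f
  unitSum-lift f per = begin
    Σ< (q * L) (λ k → U (q * L) k * f k)
      ≡⟨ Σ-block q L _ ⟩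
    Σ< q (λ t → Σ< L (λ c → U (q * L) (t * L + c) * f (t * L + c)))
      ≡⟨ Σ-cong q (λ t _ → Σ-cong L (λ c _ → cong (U (q * L) (t * L + c) *_) (periodic-multiple per t c))) ⟩
    Σ< q (λ t → Σ< L (λ c → U (q * L) (t * L + c) * f c))
      ≡⟨ Σ-swap q L _ ⟩
    Σ< L (λ c → Σ< q (λ t → U (q * L) (t * L + c) * f c))
      ≡⟨ Σ-cong L (λ c _ → trans (sym (Σ-*ʳ q (f c) _)) (cong (_* f c) (fibre c))) ⟩
    Σ< L (λ c → liftFactor * U L c * f c)
      ≡⟨ Σ-cong L (λ c _ → *-assoc liftFactor (U L c) (f c)) ⟩
    Σ< L (λ c → liftFactor * (U L c * f c))
      ≡⟨ sym (Σ-*ˡ L liftFactor _) ⟩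
    liftFactor * Σ< L (λ c → U L c * f c) ∎

  totient-lift : totient (q * L) ≡ liftFactor * totient L
  totient-lift = begin
    totient (q * L)                  ≡⟨ totient≡unitSum (q * L) ⟩
    unitSum (q * L) (λ _ → 1)        ≡⟨ unitSum-lift (λ _ → 1) (λ _ → refl) ⟩
    liftFactor * unitSum L (λ _ → 1) ≡⟨ cong (liftFactor *_) (sym (totient≡unitSum L)) ⟩
    liftFactor * totient L           ∎

-- Uniformity for M = q₁ ⋯ qᵣ · L with primes qᵢ: apply unitSum-lift once per prime and
-- cancel the lift factors, using totient-lift.
unitSum-primes : ∀ qs → All Prime qs → ∀ L f → Periodic L f →
  totient L * unitSum (product qs * L) f ≡ totient (product qs * L) * unitSum L f
unitSum-primes []       _ L f per rewrite +-identityʳ L = refl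
unitSum-primes (q ∷ qs) (q-prime ∷ qs-prime) L f per rewrite *-CS.xy∙z≈y∙xz q (product qs) L =
  *-cancelˡ-≡ _ _ liftFactor {{>-nonZero liftFactor>0}} (begin
    liftFactor * (totient L * unitSum M f)   ≡⟨ sym (*-assoc liftFactor (totient L) _) ⟩
    (liftFactor * totient L) * unitSum M f   ≡⟨ cong (_* unitSum M f) (sym totient-lift) ⟩
    totient (q * L) * unitSum M f            ≡⟨ unitSum-primes qs qs-prime (q * L) f (periodic-multiple per q) ⟩
    totient M * unitSum (q * L) f            ≡⟨ cong (totient M *_) (unitSum-lift f per) ⟩
    totient M * (liftFactor * unitSum L f)   ≡⟨ *-CS.x∙yz≈y∙xz (totient M) liftFactor _ ⟩
    liftFactor * (totient M * unitSum L f)   ∎)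
  where
  open PrimeLift q L q-prime
  M : ℕ
  M = product qs * (q * L)

-- Uniformity: if L ∣ M, the units modulo M are spread evenly over the units modulo L,
-- so for every L-periodic f,  φ(L) · Σ_{k<M unit} f k = φ(M) · Σ_{k<L unit} f k.
-- (Factor M / L into primes.)
unitSum-uniform : ∀ L M .{{_ : NonZero M}} → L ∣ M → ∀ f → Periodic L f →
  totient L * unitSum M f ≡ totient M * unitSum L f
unitSum-uniform L M (divides r M≡rL) f per =
  subst (λ N → totient L * unitSum N f ≡ totient N * unitSum L f) (sym M≡PL)
        (unitSum-primes factors factorsPrime L f per)
  where
  instance
    r≢0 : NonZero r
    r≢0 = m*n≢0⇒m≢0 r {L} {{subst NonZero M≡rL it}}
  open Fact.PrimeFactorisation (Fact.factorise r)
  M≡PL : M ≡ product factors * L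
  M≡PL = trans M≡rL (cong (_* L) isFactorisation)

-- Σ∣ n g = Σ_{d ∣ n} g d  (for n > 0 the divisors of n lie in [1, n]).
Σ∣ : ℕ → (ℕ → ℕ) → ℕ
Σ∣ n g = Σ< n (λ i → 𝟙 (suc i ∣? n) * g (suc i))

Σ∣-cong : ∀ n {f g : ℕ → ℕ} → (∀ d .{{_ : NonZero d}} → d ∣ n → f d ≡ g d) → Σ∣ n f ≡ Σ∣ n g
Σ∣-cong n {f} {g} f≗g = Σ-cong n (λ i _ → term (suc i) (suc i ∣? n))
  where
  term : ∀ d .{{_ : NonZero d}} (dec : Dec (d ∣ n)) → 𝟙 dec * f d ≡ 𝟙 dec * g d
  term d (yes d∣n) = cong (_+ 0) (f≗g d d∣n)
  term d (no _)    = refl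

Σ∣-*ˡ : ∀ n c (f : ℕ → ℕ) → c * Σ∣ n f ≡ Σ∣ n (λ d → c * f d)
Σ∣-*ˡ n c f = trans (Σ-*ˡ n c _) (Σ-cong n (λ i _ → *-CS.x∙yz≈y∙xz c (𝟙 (suc i ∣? n)) (f (suc i))))

Σ∣-prod : ∀ m n (f g : ℕ → ℕ) → Σ∣ m f * Σ∣ n g ≡ Σ∣ m (λ d → Σ∣ n (λ e → f d * g e))
Σ∣-prod m n f g = trans (Σ-*ʳ m (Σ∣ n g) _) (Σ-cong m (λ i _ →
  trans (*-assoc (𝟙 (suc i ∣? m)) (f (suc i)) _) (cong (𝟙 (suc i ∣? m) *_) (Σ∣-*ˡ n (f (suc i)) g))))

Σ-Σ∣-swap : ∀ M n (f : ℕ → ℕ → ℕ) → Σ< M (λ k → Σ∣ n (λ d → f d k)) ≡ Σ∣ n (λ d → Σ< M (f d))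
Σ-Σ∣-swap M n f = trans (Σ-swap M n _) (Σ-cong n (λ i _ → sym (Σ-*ˡ M (𝟙 (suc i ∣? n)) (f (suc i)))))

gcd>0 : ∀ x m → 0 < m → 0 < gcd x m
gcd>0 x m m>0 = n≢0⇒n>0 (λ g≡0 → <⇒≢ m>0 (sym (gcd[m,n]≡0⇒n≡0 x g≡0)))

-- cofactor n i j = [(j + 1) · gcd(i, n) = n], i.e. j + 1 is the cofactor n / gcd(i, n).
cofactor : ℕ → ℕ → ℕ → ℕ
cofactor n i j = 𝟙 (suc j * gcd i n ≟ n)

cofactor-unique : ∀ n → 0 < n → ∀ i → Σ< n (cofactor n i) ≡ 1
cofactor-unique n n>0 i = count≡1 (λ j → suc j * g ≟ n) n
  (λ a b _ _ ha hb → suc-injective (*-cancelʳ-≡ (suc a) (suc b) g {{>-nonZero (gcd>0 i n n>0)}} (trans ha (sym hb))))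
  (w ∸ 1) (<-≤-trans (∸-monoʳ-< z<s w>0) (∣⇒≤ {{>-nonZero n>0}} (quotient-∣ g∣n)))
  (trans (cong (_* g) (m+[n∸m]≡n {1} {w} w>0)) (sym (m∣n⇒n≡quotient*m g∣n)))
  where
  g : ℕ
  g = gcd i n
  g∣n : g ∣ n
  g∣n = gcd[m,n]∣n i n
  w : ℕ
  w = quotient g∣n
  w>0 : 0 < w
  w>0 = >-nonZero⁻¹ w {{quotient≢0 g∣n {{>-nonZero n>0}}}}

-- For n = d·e, the i < n with cofactor d are the multiples i = t·e with t < d a unit
-- modulo d; there are φ(d) of them.
cofactor-count : ∀ n → 0 < n → ∀ j (dec : Dec (suc j ∣ n)) →
                 Σ< n (λ i → cofactor n i j) ≡ 𝟙 dec * totient (suc j)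
cofactor-count n n>0 j (no d∤n) = Σ-zero n _ (λ i _ → 𝟙-no (suc j * gcd i n ≟ n)
  (λ h → d∤n (divides (gcd i n) (trans (sym h) (*-comm (suc j) _)))))
cofactor-count n n>0 j (yes (divides e n≡ed)) = begin
  Σ< n (λ i → cofactor n i j)                         ≡⟨ cong (λ N → Σ< N (λ i → cofactor n i j)) n≡de ⟩
  Σ< (d * e) (λ i → cofactor n i j)                   ≡⟨ Σ-block d e _ ⟩
  Σ< d (λ t → Σ< e (λ r → cofactor n (t * e + r) j))  ≡⟨ Σ-cong d (λ t _ → block t) ⟩
  Σ< d (U d)                                          ≡⟨ sym (+-identityʳ _) ⟩
  1 * totient d                                       ∎
  where
  d : ℕ
  d = suc j
  n≡de : n ≡ d * e
  n≡de = trans n≡ed (*-comm e d)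
  e>0 : 0 < e
  e>0 = n≢0⇒n>0 (λ e≡0 → <⇒≢ n>0 (sym (trans n≡ed (cong (_* d) e≡0))))
  -- d · gcd(i, n) = n forces gcd(i, n) = e, so e ∣ i
  off-multiple : ∀ t r → suc r < e → cofactor n (t * e + suc r) j ≡ 0
  off-multiple t r r<e = 𝟙-no (d * gcd i n ≟ n) (λ h →
    let e∣i = subst (_∣ i) (*-cancelˡ-≡ _ e d (trans h n≡de)) (gcd[m,n]∣m i n)
    in 0≢1+n (sym (∣<⇒≡0 (∣m+n∣m⇒∣n e∣i (n∣m*n t)) r<e)))
    where
    i : ℕ
    i = t * e + suc r
  gcd-multiple : ∀ t → gcd (t * e + 0) n ≡ e * gcd t d
  gcd-multiple t = trans (cong₂ gcd (trans (+-identityʳ (t * e)) (*-comm t e)) (trans n≡de (*-comm d e)))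
                         (sym (c*gcd[m,n]≡gcd[cm,cn] e t d))
  multiple : ∀ t → cofactor n (t * e + 0) j ≡ U d t
  multiple t = 𝟙-⇔
    (λ h → *-cancelˡ-≡ (gcd t d) 1 (d * e) {{m*n≢0 d e {{_}} {{>-nonZero e>0}}}}
      (trans (*-assoc d e (gcd t d)) (trans (sym (cong (d *_) (gcd-multiple t))) (trans h (trans n≡de (sym (*-identityʳ _)))))))
    (λ h → trans (cong (d *_) (trans (gcd-multiple t) (trans (cong (e *_) h) (*-identityʳ e)))) (sym n≡de))
    (d * gcd (t * e + 0) n ≟ n) (gcd t d ≟ 1)
  block : ∀ t → Σ< e (λ r → cofactor n (t * e + r) j) ≡ U d t
  block t = trans (Σ-head e (λ r → cofactor n (t * e + r) j) e>0 (off-multiple t)) (multiple t)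

-- Gauss: Σ_{d ∣ n} φ(d) = n, by sorting the i < n according to their cofactor.
Σ∣-totient : ∀ n → 0 < n → Σ∣ n totient ≡ n
Σ∣-totient n n>0 = begin
  Σ< n (λ j → 𝟙 (suc j ∣? n) * totient (suc j))   ≡⟨ Σ-cong n (λ j _ → sym (cofactor-count n n>0 j (suc j ∣? n))) ⟩
  Σ< n (λ j → Σ< n (λ i → cofactor n i j))        ≡⟨ Σ-swap n n (λ j i → cofactor n i j) ⟩
  Σ< n (λ i → Σ< n (cofactor n i))                ≡⟨ Σ-cong n (λ i _ → cofactor-unique n n>0 i) ⟩
  Σ< n (λ _ → 1)                                  ≡⟨ trans (Σ-const n 1) (*-identityʳ n) ⟩
  n                                               ∎

-- gcd(x, m) = Σ_{d ∣ m, d ∣ x} φ(d): Gauss's identity for gcd(x, m), whose divisors are the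
-- common divisors of x and m.
gcd-as-Σ∣ : ∀ m → 0 < m → ∀ x → gcd x m ≡ Σ∣ m (λ d → 𝟙 (d ∣? x) * totient d)
gcd-as-Σ∣ m m>0 x = begin
  g                                                            ≡⟨ sym (Σ∣-totient g g>0) ⟩
  Σ< g (λ i → 𝟙 (suc i ∣? g) * totient (suc i))                 ≡⟨ sym (Σ-extend g m _ g≤m beyond-g) ⟩
  Σ< m (λ i → 𝟙 (suc i ∣? g) * totient (suc i))                 ≡⟨ Σ-cong m (λ i _ → split (suc i)) ⟩
  Σ< m (λ i → 𝟙 (suc i ∣? m) * (𝟙 (suc i ∣? x) * totient (suc i))) ∎
  where
  g : ℕ
  g = gcd x m
  g>0 : 0 < g
  g>0 = gcd>0 x m m>0
  g≤m : g ≤ m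
  g≤m = gcd[m,n]≤n x m {{>-nonZero m>0}}
  beyond-g : ∀ i → g ≤ i → i < m → 𝟙 (suc i ∣? g) * totient (suc i) ≡ 0
  beyond-g i g≤i _ = cong (_* totient (suc i))
    (𝟙-no (suc i ∣? g) (λ h → <⇒≱ (s≤s g≤i) (∣⇒≤ {{>-nonZero g>0}} h)))
  split : ∀ d → 𝟙 (d ∣? g) * totient d ≡ 𝟙 (d ∣? m) * (𝟙 (d ∣? x) * totient d)
  split d = trans (cong (_* totient d) (trans
    (𝟙-⇔ (λ h → ∣-trans h (gcd[m,n]∣n x m) , ∣-trans h (gcd[m,n]∣m x m)) (λ (d∣m , d∣x) → gcd-greatest d∣x d∣m)
         (d ∣? g) ((d ∣? m) ×-dec (d ∣? x)))
    (𝟙-× (d ∣? m) (d ∣? x))))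
    (*-assoc (𝟙 (d ∣? m)) _ _)

admissible : ℕ → ℕ → ℕ → ℕ → ℕ
admissible c₁ c₂ d₁ d₂ = 𝟙 (coprime? d₁ c₁ ×-dec (coprime? d₂ c₂ ×-dec coprime? d₁ d₂))

admissible-cong : ∀ {c₁ c₂ c₁′ c₂′ d₁ d₂} → gcd d₁ c₁ ≡ gcd d₁ c₁′ → gcd d₂ c₂ ≡ gcd d₂ c₂′ →
                  admissible c₁ c₂ d₁ d₂ ≡ admissible c₁′ c₂′ d₁ d₂
admissible-cong {c₁} {c₂} {c₁′} {c₂′} {d₁} {d₂} eq₁ eq₂ =
  𝟙-⇔ {P = Coprime d₁ c₁ × Coprime d₂ c₂ × Coprime d₁ d₂} {Q = Coprime d₁ c₁′ × Coprime d₂ c₂′ × Coprime d₁ d₂}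
  (λ (h₁ , h₂ , h₁₂) → via {d₁} eq₁ h₁ , via {d₂} eq₂ h₂ , h₁₂)
  (λ (h₁ , h₂ , h₁₂) → via {d₁} (sym eq₁) h₁ , via {d₂} (sym eq₂) h₂ , h₁₂)
  (coprime? d₁ c₁ ×-dec (coprime? d₂ c₂ ×-dec coprime? d₁ d₂))
  (coprime? d₁ c₁′ ×-dec (coprime? d₂ c₂′ ×-dec coprime? d₁ d₂))
  where
  via : ∀ {d x y} → gcd d x ≡ gcd d y → Coprime d x → Coprime d y
  via {d} {x} {y} eq c = toCop {d} {y} (trans (sym eq) (toGcd {d} {x} c))

admissible-1ˡ : ∀ c₁ c₂ d → admissible c₁ c₂ 1 d ≡ 𝟙 (coprime? d c₂)
admissible-1ˡ c₁ c₂ d = 𝟙-⇔ {P = Coprime 1 c₁ × Coprime d c₂ × Coprime 1 d} (proj₁ ∘ proj₂)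
  (λ h → Cop.1-coprimeTo c₁ , h , Cop.1-coprimeTo d)
  (coprime? 1 c₁ ×-dec (coprime? d c₂ ×-dec coprime? 1 d)) (coprime? d c₂)

admissible-1ʳ : ∀ c₁ c₂ d → admissible c₁ c₂ d 1 ≡ 𝟙 (coprime? d c₁)
admissible-1ʳ c₁ c₂ d = 𝟙-⇔ {P = Coprime d c₁ × Coprime 1 c₂ × Coprime d 1} proj₁
  (λ h → h , Cop.1-coprimeTo c₂ , Cop.sym (Cop.1-coprimeTo d))
  (coprime? d c₁ ×-dec (coprime? 1 c₂ ×-dec coprime? d 1)) (coprime? d c₁)

admissible-common : ∀ c₁ c₂ {e d₁ d₂} → 1 < e → e ∣ d₁ → e ∣ d₂ → admissible c₁ c₂ d₁ d₂ ≡ 0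
admissible-common c₁ c₂ {e} {d₁} {d₂} 1<e e∣d₁ e∣d₂ =
  𝟙-no (coprime? d₁ c₁ ×-dec (coprime? d₂ c₂ ×-dec coprime? d₁ d₂))
       (λ (_ , _ , d₁⊥d₂) → <⇒≢ 1<e (sym (d₁⊥d₂ (e∣d₁ , e∣d₂))))

δ-periodic : ∀ {d D} c → d ∣ D → Periodic D (δ d c)
δ-periodic {d} {D} c d∣D k = 𝟙-⇔
  (λ h → proj₁ (∣-shift d∣D) (subst (d ∣_) (+-assoc D k c) h))
  (λ h → subst (d ∣_) (sym (+-assoc D k c)) (proj₂ (∣-shift d∣D) h))
  (d ∣? (D + k + c)) (d ∣? (k + c))

-- Fix M > 0 and shifts s₁, s₂ such that k + s₁ and k + s₂ never share a divisor > 1 of M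
-- (for s = -a mod M this is the hypothesis |a₁ - a₂| = 1).
module Core (M s₁ s₂ : ℕ) .{{_ : NonZero M}}
            (separated : ∀ g k → g ∣ M → g ∣ k + s₁ → g ∣ k + s₂ → g ≡ 1) where

  χ : ℕ → ℕ → ℕ → ℕ
  χ d₁ d₂ k = δ d₁ s₁ k * δ d₂ s₂ k

  admissible-if-hit : ∀ {d₁ d₂} → d₁ ∣ M → d₂ ∣ M → ∀ k → Coprime k M → d₁ ∣ k + s₁ → d₂ ∣ k + s₂ →
                      Coprime d₁ s₁ × Coprime d₂ s₂ × Coprime d₁ d₂
  admissible-if-hit {d₁} {d₂} d₁∣M d₂∣M k k⊥M h₁ h₂ =
      (λ (e∣d₁ , e∣s₁) → k⊥M (∣m+n∣m⇒∣n (∣-trans e∣d₁ h₁′) e∣s₁ , ∣-trans e∣d₁ d₁∣M))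
    , (λ (e∣d₂ , e∣s₂) → k⊥M (∣m+n∣m⇒∣n (∣-trans e∣d₂ h₂′) e∣s₂ , ∣-trans e∣d₂ d₂∣M))
    , (λ (e∣d₁ , e∣d₂) → separated _ k (∣-trans e∣d₁ d₁∣M) (∣-trans e∣d₁ h₁) (∣-trans e∣d₂ h₂))
    where
    h₁′ : d₁ ∣ s₁ + k
    h₁′ = subst (d₁ ∣_) (+-comm k s₁) h₁
    h₂′ : d₂ ∣ s₂ + k
    h₂′ = subst (d₂ ∣_) (+-comm k s₂) h₂

  unitSum-inadmissible : ∀ {d₁ d₂} → d₁ ∣ M → d₂ ∣ M → ¬ (Coprime d₁ s₁ × Coprime d₂ s₂ × Coprime d₁ d₂) →
                         unitSum M (χ d₁ d₂) ≡ 0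
  unitSum-inadmissible {d₁} {d₂} d₁∣M d₂∣M inadmissible =
    Σ-zero M _ (λ k _ → vanish k (gcd k M ≟ 1) (d₁ ∣? (k + s₁)) (d₂ ∣? (k + s₂)))
    where
    vanish : ∀ k (u : Dec (gcd k M ≡ 1)) (x : Dec (d₁ ∣ k + s₁)) (y : Dec (d₂ ∣ k + s₂)) → 𝟙 u * (𝟙 x * 𝟙 y) ≡ 0
    vanish k (yes k⊥M) (yes h₁) (yes h₂) = contradiction (admissible-if-hit d₁∣M d₂∣M k (toCop k⊥M) h₁ h₂) inadmissible
    vanish k (yes _)   (yes _)  (no _)   = refl
    vanish k (yes _)   (no _)   _        = refl
    vanish k (no _)    _        _        = refl

  -- An admissible pair of classes contains φ(M) / φ(d₁d₂) units: by uniformity this is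
  -- φ(M) / φ(D) times the number of units modulo D = d₁d₂ in the classes, which is 1 by
  -- the Chinese remainder theorem since every element of both classes is a unit.
  unitSum-admissible : ∀ d₁ d₂ .{{_ : NonZero d₁}} .{{_ : NonZero d₂}} → d₁ ∣ M → d₂ ∣ M →
                       Coprime d₁ s₁ → Coprime d₂ s₂ → Coprime d₁ d₂ →
                       totient d₁ * totient d₂ * unitSum M (χ d₁ d₂) ≡ totient M * 1
  unitSum-admissible d₁ d₂ d₁∣M d₂∣M d₁⊥s₁ d₂⊥s₂ d₁⊥d₂ = begin
    totient d₁ * totient d₂ * unitSum M (χ d₁ d₂)   ≡⟨ cong (_* unitSum M (χ d₁ d₂)) (sym (totient-* d₁ d₂ d₁⊥d₂)) ⟩
    totient D * unitSum M (χ d₁ d₂)                 ≡⟨ unitSum-uniform D M (coprime-∣⇒*∣ d₁⊥d₂ d₁∣M d₂∣M) (χ d₁ d₂) χ-periodic ⟩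
    totient M * unitSum D (χ d₁ d₂)                 ≡⟨ cong (totient M *_) (Σ-cong D (λ k _ → units-only k)) ⟩
    totient M * Σ< D (χ d₁ d₂)                      ≡⟨ cong (totient M *_) (crt-count d₁ d₂ d₁⊥d₂ s₁ s₂) ⟩
    totient M * 1                                   ∎
    where
    D : ℕ
    D = d₁ * d₂
    χ-periodic : Periodic D (χ d₁ d₂)
    χ-periodic k = cong₂ _*_ (δ-periodic {d₁} s₁ (∣m⇒∣m*n d₂ ∣-refl) k) (δ-periodic {d₂} s₂ (∣n⇒∣m*n d₁ ∣-refl) k)
    unit : ∀ {k} → d₁ ∣ k + s₁ × d₂ ∣ k + s₂ → Coprime k D
    unit {k} (h₁ , h₂) = coprime-*⇐ {k} {d₁} {d₂}
      (coprime-complement h₁ (Cop.sym d₁⊥s₁)) (coprime-complement h₂ (Cop.sym d₂⊥s₂))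
    units-only : ∀ k → U D k * χ d₁ d₂ k ≡ χ d₁ d₂ k
    units-only k = begin
      U D k * χ d₁ d₂ k                                ≡⟨ cong (U D k *_) (sym (𝟙-× hit₁ hit₂)) ⟩
      U D k * 𝟙 (hit₁ ×-dec hit₂)                      ≡⟨ U-absorb unit (hit₁ ×-dec hit₂) ⟩
      𝟙 (hit₁ ×-dec hit₂)                              ≡⟨ 𝟙-× hit₁ hit₂ ⟩
      χ d₁ d₂ k                                        ∎
      where
      hit₁ : Dec (d₁ ∣ k + s₁)
      hit₁ = d₁ ∣? (k + s₁)
      hit₂ : Dec (d₂ ∣ k + s₂)
      hit₂ = d₂ ∣? (k + s₂)

  classCount : ∀ d₁ d₂ .{{_ : NonZero d₁}} .{{_ : NonZero d₂}} → d₁ ∣ M → d₂ ∣ M →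
               totient d₁ * totient d₂ * unitSum M (χ d₁ d₂) ≡ totient M * admissible s₁ s₂ d₁ d₂
  classCount d₁ d₂ d₁∣M d₂∣M = byAdmissibility (coprime? d₁ s₁ ×-dec (coprime? d₂ s₂ ×-dec coprime? d₁ d₂))
    where
    byAdmissibility : (adm : Dec (Coprime d₁ s₁ × Coprime d₂ s₂ × Coprime d₁ d₂)) →
                      totient d₁ * totient d₂ * unitSum M (χ d₁ d₂) ≡ totient M * 𝟙 adm
    byAdmissibility (yes (d₁⊥s₁ , d₂⊥s₂ , d₁⊥d₂)) = unitSum-admissible d₁ d₂ d₁∣M d₂∣M d₁⊥s₁ d₂⊥s₂ d₁⊥d₂
    byAdmissibility (no inadmissible) = begin
      totient d₁ * totient d₂ * unitSum M (χ d₁ d₂)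
        ≡⟨ cong (totient d₁ * totient d₂ *_) (unitSum-inadmissible d₁∣M d₂∣M inadmissible) ⟩
      totient d₁ * totient d₂ * 0   ≡⟨ *-zeroʳ (totient d₁ * totient d₂) ⟩
      0                             ≡⟨ sym (*-zeroʳ (totient M)) ⟩
      totient M * 0                 ∎

  -- Expanding both gcds by Gauss's identity and counting units class by class:
  -- Σ_{k < M unit} gcd(k + s₁, m₁) gcd(k + s₂, m₂) = φ(M) · #{admissible d₁ ∣ m₁, d₂ ∣ m₂}.
  core : ∀ m₁ m₂ → 0 < m₁ → 0 < m₂ → m₁ ∣ M → m₂ ∣ M →
    Σ< M (λ k → U M k * (gcd (k + s₁) m₁ * gcd (k + s₂) m₂)) ≡
    totient M * Σ∣ m₁ (λ d₁ → Σ∣ m₂ (admissible s₁ s₂ d₁))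
  core m₁ m₂ m₁>0 m₂>0 m₁∣M m₂∣M = begin
    Σ< M (λ k → U M k * (gcd (k + s₁) m₁ * gcd (k + s₂) m₂))
      ≡⟨ Σ-cong M (λ k _ → expand k) ⟩
    Σ< M (λ k → Σ∣ m₁ (λ d₁ → Σ∣ m₂ (λ d₂ → W d₁ d₂ k)))
      ≡⟨ Σ-Σ∣-swap M m₁ (λ d₁ k → Σ∣ m₂ (λ d₂ → W d₁ d₂ k)) ⟩
    Σ∣ m₁ (λ d₁ → Σ< M (λ k → Σ∣ m₂ (λ d₂ → W d₁ d₂ k)))
      ≡⟨ Σ∣-cong m₁ (λ d₁ _ → Σ-Σ∣-swap M m₂ (W d₁)) ⟩
    Σ∣ m₁ (λ d₁ → Σ∣ m₂ (λ d₂ → Σ< M (W d₁ d₂)))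
      ≡⟨ Σ∣-cong m₁ (λ d₁ d₁∣m₁ → Σ∣-cong m₂ (λ d₂ d₂∣m₂ → trans (sym (Σ-*ˡ M (totient d₁ * totient d₂) (λ k → U M k * χ d₁ d₂ k)))
           (classCount d₁ d₂ (∣-trans d₁∣m₁ m₁∣M) (∣-trans d₂∣m₂ m₂∣M)))) ⟩
    Σ∣ m₁ (λ d₁ → Σ∣ m₂ (λ d₂ → totient M * admissible s₁ s₂ d₁ d₂))
      ≡⟨ sym (trans (Σ∣-*ˡ m₁ (totient M) (λ d₁ → Σ∣ m₂ (admissible s₁ s₂ d₁))) (Σ∣-cong m₁ (λ d₁ _ → Σ∣-*ˡ m₂ (totient M) (admissible s₁ s₂ d₁)))) ⟩
    totient M * Σ∣ m₁ (λ d₁ → Σ∣ m₂ (admissible s₁ s₂ d₁)) ∎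
    where
    W : ℕ → ℕ → ℕ → ℕ
    W d₁ d₂ k = totient d₁ * totient d₂ * (U M k * χ d₁ d₂ k)
    regroup : ∀ u a p b q → u * ((a * p) * (b * q)) ≡ p * q * (u * (a * b))
    regroup = solve-∀
    expand : ∀ k → U M k * (gcd (k + s₁) m₁ * gcd (k + s₂) m₂) ≡ Σ∣ m₁ (λ d₁ → Σ∣ m₂ (λ d₂ → W d₁ d₂ k))
    expand k = begin
      U M k * (gcd (k + s₁) m₁ * gcd (k + s₂) m₂)
        ≡⟨ cong (U M k *_) (cong₂ _*_ (gcd-as-Σ∣ m₁ m₁>0 (k + s₁)) (gcd-as-Σ∣ m₂ m₂>0 (k + s₂))) ⟩
      U M k * (Σ∣ m₁ (λ d₁ → δ d₁ s₁ k * totient d₁) * Σ∣ m₂ (λ d₂ → δ d₂ s₂ k * totient d₂))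
        ≡⟨ cong (U M k *_) (Σ∣-prod m₁ m₂ (λ d₁ → δ d₁ s₁ k * totient d₁) (λ d₂ → δ d₂ s₂ k * totient d₂)) ⟩
      U M k * Σ∣ m₁ (λ d₁ → Σ∣ m₂ (λ d₂ → (δ d₁ s₁ k * totient d₁) * (δ d₂ s₂ k * totient d₂)))
        ≡⟨ trans (Σ∣-*ˡ m₁ (U M k) (λ d₁ → Σ∣ m₂ (λ d₂ → (δ d₁ s₁ k * totient d₁) * (δ d₂ s₂ k * totient d₂)))) (Σ∣-cong m₁ (λ d₁ _ → Σ∣-*ˡ m₂ (U M k) (λ d₂ → (δ d₁ s₁ k * totient d₁) * (δ d₂ s₂ k * totient d₂)))) ⟩
      Σ∣ m₁ (λ d₁ → Σ∣ m₂ (λ d₂ → U M k * ((δ d₁ s₁ k * totient d₁) * (δ d₂ s₂ k * totient d₂))))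
        ≡⟨ Σ∣-cong m₁ (λ d₁ _ → Σ∣-cong m₂ (λ d₂ _ → regroup (U M k) (δ d₁ s₁ k) (totient d₁) (δ d₂ s₂ k) (totient d₂))) ⟩
      Σ∣ m₁ (λ d₁ → Σ∣ m₂ (λ d₂ → W d₁ d₂ k)) ∎

-- The list-based φ of the statement is the totient; the shift k ↦ k - 1 uses U M M = U M 0.
φ≡totient : ∀ M → φ M ≡ totient M
φ≡totient M = begin
  length (filter (λ k → gcd k M ≟ 1) (range1 M))   ≡⟨ length-filter (λ k → gcd k M ≟ 1) (range1 M) ⟩
  sum (map (U M) (range1 M))                       ≡⟨ sum-range1 (U M) M ⟩
  Σ< M (U M ∘ suc)                                 ≡⟨ Σ-rotate M (U M) (U-period M) ⟩
  totient M                                        ∎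

pairCount≡Σ∣ : ∀ a₁ a₂ m₁ m₂ → pairCount a₁ a₂ m₁ m₂ ≡ Σ∣ m₁ (λ d₁ → Σ∣ m₂ (admissible ℤ.∣ a₁ ∣ ℤ.∣ a₂ ∣ d₁))
pairCount≡Σ∣ a₁ a₂ m₁ m₂ = begin
  pairCount a₁ a₂ m₁ m₂
    ≡⟨ length-filter _ (cartesianProduct (divisors m₁) (divisors m₂)) ⟩
  sum (map (λ (d₁ , d₂) → adm d₁ d₂) (cartesianProduct (divisors m₁) (divisors m₂)))
    ≡⟨ sum-cartesianProduct _ (divisors m₁) (divisors m₂) ⟩
  sum (map (λ d₁ → sum (map (adm d₁) (divisors m₂))) (divisors m₁))
    ≡⟨ divisor-list m₁ (λ d₁ → sum (map (adm d₁) (divisors m₂))) ⟩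
  Σ∣ m₁ (λ d₁ → sum (map (adm d₁) (divisors m₂)))
    ≡⟨ Σ∣-cong m₁ (λ d₁ _ → divisor-list m₂ (adm d₁)) ⟩
  Σ∣ m₁ (λ d₁ → Σ∣ m₂ (adm d₁)) ∎
  where
  adm : ℕ → ℕ → ℕ
  adm = admissible ℤ.∣ a₁ ∣ ℤ.∣ a₂ ∣
  divisor-list : ∀ m (h : ℕ → ℕ) → sum (map h (divisors m)) ≡ Σ∣ m h
  divisor-list m h = trans (sum-filter (_∣? m) h (range1 m)) (sum-range1 (λ d → 𝟙 (d ∣? m) * h d) m)

∣⇒∣ℤ : ∀ {d n} → d ∣ n → ℤ.+ d ℤS.∣ ℤ.+ n
∣⇒∣ℤ = ℤS.∣ᵤ⇒∣

gcdℤ-mod : ∀ (x : ℤ) y m → ℤ.+ m ℤS.∣ (x ℤ.- ℤ.+ y) → gcdℤ x m ≡ gcd y m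
gcdℤ-mod x y m m∣x-y = ∣-antisym
  (gcd-greatest (ℤS.∣⇒∣ᵤ (subst (ℤ.+ gcdℤ x m ℤS.∣_) (x-[x-y]≡y x (ℤ.+ y))
     (ℤS.∣m∣n⇒∣m-n (ℤS.∣ᵤ⇒∣ {ℤ.+ gcdℤ x m} {x} (gcd[m,n]∣m (ℤ.∣ x ∣) m))
                   (ℤS.∣-trans (∣⇒∣ℤ (gcd[m,n]∣n (ℤ.∣ x ∣) m)) m∣x-y))))
     (gcd[m,n]∣n (ℤ.∣ x ∣) m))
  (gcd-greatest (ℤS.∣⇒∣ᵤ {ℤ.+ gcd y m} {x} (subst (ℤ.+ gcd y m ℤS.∣_) ([x-y]+y≡x x (ℤ.+ y))
     (ℤS.∣m∣n⇒∣m+n (ℤS.∣-trans (∣⇒∣ℤ (gcd[m,n]∣n y m)) m∣x-y) (∣⇒∣ℤ (gcd[m,n]∣m y m)))))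
     (gcd[m,n]∣n y m))
  where
  x-[x-y]≡y : ∀ x y → x ℤ.- (x ℤ.- y) ≡ y
  x-[x-y]≡y = ℤ-solve-∀
  [x-y]+y≡x : ∀ x y → (x ℤ.- y) ℤ.+ y ≡ x
  [x-y]+y≡x = ℤ-solve-∀

gcd-translate : ∀ {m D} y → m ∣ D → gcd (D + y) m ≡ gcd y m
gcd-translate {m} {D} y m∣D = ∣-antisym
  (gcd-greatest (∣m+n∣m⇒∣n (gcd[m,n]∣m (D + y) m) (∣-trans (gcd[m,n]∣n (D + y) m) m∣D)) (gcd[m,n]∣n (D + y) m))
  (gcd-greatest (∣m∣n⇒∣m+n (∣-trans (gcd[m,n]∣n y m) m∣D) (gcd[m,n]∣m y m)) (gcd[m,n]∣n y m))

gap-unit : ∀ a₁ a₂ → ℤ.∣ a₁ ℤ.- a₂ ∣ ≡ 1 → ∀ {g} → ℤ.+ g ℤS.∣ (a₁ ℤ.- a₂) → g ≡ 1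
gap-unit a₁ a₂ gap {g} g∣ = ∣1⇒≡1 (subst (g ∣_) gap (ℤS.∣⇒∣ᵤ {ℤ.+ g} {a₁ ℤ.- a₂} g∣))

-- Replacing each integer a by the natural shift s(a) = (-a) mod M, so that k - a ≡ k + s(a) (mod M).
module Shift (M : ℕ) .{{_ : NonZero M}} where
  s : ℤ → ℕ
  s a = (ℤ.- a) %ℕ M

  M∣-a-s : ∀ a → ℤ.+ M ℤS.∣ (ℤ.- a ℤ.- ℤ.+ s a)
  M∣-a-s a = ℤS.divides ((ℤ.- a) /ℕ M)
    (trans (cong (λ z → z ℤ.- ℤ.+ s a) (a≡a%ℕn+[a/ℕn]*n (ℤ.- a) M)) (s+t-s≡t (ℤ.+ s a) _))
    where
    s+t-s≡t : ∀ s t → (s ℤ.+ t) ℤ.- s ≡ t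
    s+t-s≡t = ℤ-solve-∀

  ∣k-a : ∀ a {g} k → g ∣ M → g ∣ k + s a → ℤ.+ g ℤS.∣ (ℤ.+ k ℤ.- a)
  ∣k-a a {g} k g∣M g∣ = subst (ℤ.+ g ℤS.∣_) regroup
    (ℤS.∣m∣n⇒∣m+n (∣⇒∣ℤ g∣) (ℤS.∣-trans (∣⇒∣ℤ g∣M) (M∣-a-s a)))
    where
    regroup : ℤ.+ (k + s a) ℤ.+ (ℤ.- a ℤ.- ℤ.+ s a) ≡ ℤ.+ k ℤ.- a
    regroup = trans (cong (λ z → z ℤ.+ (ℤ.- a ℤ.- ℤ.+ s a)) (ℤP.pos-+ k (s a))) (cancel (ℤ.+ k) a (ℤ.+ s a))
      where
      cancel : ∀ k a s → (k ℤ.+ s) ℤ.+ (ℤ.- a ℤ.- s) ≡ k ℤ.- a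
      cancel = ℤ-solve-∀

  gcd-k-a : ∀ a {m} → m ∣ M → ∀ k → gcdℤ (ℤ.+ k ℤ.- a) m ≡ gcd (k + s a) m
  gcd-k-a a {m} m∣M k = gcdℤ-mod (ℤ.+ k ℤ.- a) (k + s a) m
    (subst (ℤ.+ m ℤS.∣_) (sym difference) (ℤS.∣-trans (∣⇒∣ℤ m∣M) (M∣-a-s a)))
    where
    difference : (ℤ.+ k ℤ.- a) ℤ.- ℤ.+ (k + s a) ≡ ℤ.- a ℤ.- ℤ.+ s a
    difference = trans (cong (λ z → (ℤ.+ k ℤ.- a) ℤ.- z) (ℤP.pos-+ k (s a))) (cancel (ℤ.+ k) a (ℤ.+ s a))
      where
      cancel : ∀ k a s → (k ℤ.- a) ℤ.- (k ℤ.+ s) ≡ ℤ.- a ℤ.- s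
      cancel = ℤ-solve-∀

  -- gcd(d, a) = gcd(d, s(a)) for d ∣ M, as s(a) ≡ -a (mod d)
  gcd-a : ∀ a {d} → d ∣ M → gcd d (ℤ.∣ a ∣) ≡ gcd d (s a)
  gcd-a a {d} d∣M = begin
    gcd d (ℤ.∣ a ∣)      ≡⟨ gcd-comm d (ℤ.∣ a ∣) ⟩
    gcd (ℤ.∣ a ∣) d      ≡⟨ cong (λ z → gcd z d) (sym (ℤP.∣-i∣≡∣i∣ a)) ⟩
    gcd (ℤ.∣ ℤ.- a ∣) d  ≡⟨ gcdℤ-mod (ℤ.- a) (s a) d (ℤS.∣-trans (∣⇒∣ℤ d∣M) (M∣-a-s a)) ⟩
    gcd (s a) d          ≡⟨ gcd-comm (s a) d ⟩
    gcd d (s a)          ∎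

  admissible-shift : ∀ a₁ a₂ {d₁ d₂} → d₁ ∣ M → d₂ ∣ M →
                     admissible ℤ.∣ a₁ ∣ ℤ.∣ a₂ ∣ d₁ d₂ ≡ admissible (s a₁) (s a₂) d₁ d₂
  admissible-shift a₁ a₂ {d₁} {d₂} d₁∣M d₂∣M =
    admissible-cong {d₁ = d₁} {d₂} (gcd-a a₁ d₁∣M) (gcd-a a₂ d₂∣M)

  separated : ∀ a₁ a₂ → ℤ.∣ a₁ ℤ.- a₂ ∣ ≡ 1 → ∀ g k → g ∣ M → g ∣ k + s a₁ → g ∣ k + s a₂ → g ≡ 1
  separated a₁ a₂ gap g k g∣M h₁ h₂ = gap-unit a₁ a₂ gap
    (subst (ℤ.+ g ℤS.∣_) (difference (ℤ.+ k) a₁ a₂) (ℤS.∣m∣n⇒∣m-n (∣k-a a₂ k g∣M h₂) (∣k-a a₁ k g∣M h₁)))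
    where
    difference : ∀ k a b → (k ℤ.- b) ℤ.- (k ℤ.- a) ≡ a ℤ.- b
    difference = ℤ-solve-∀

  RSum≡Σ : ∀ a₁ a₂ {m₁ m₂} → m₁ ∣ M → m₂ ∣ M →
    RSum a₁ a₂ m₁ m₂ M ≡ Σ< M (λ k → U M k * (gcd (k + s a₁) m₁ * gcd (k + s a₂) m₂))
  RSum≡Σ a₁ a₂ {m₁} {m₂} m₁∣M m₂∣M = begin
    RSum a₁ a₂ m₁ m₂ M
      ≡⟨ sum-filter (λ k → gcd k M ≟ 1) _ (range1 M) ⟩
    sum (map (λ k → U M k * (gcdℤ (ℤ.+ k ℤ.- a₁) m₁ * gcdℤ (ℤ.+ k ℤ.- a₂) m₂)) (range1 M))
      ≡⟨ sum-range1 _ M ⟩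
    Σ< M (λ i → U M (suc i) * (gcdℤ (ℤ.+ suc i ℤ.- a₁) m₁ * gcdℤ (ℤ.+ suc i ℤ.- a₂) m₂))
      ≡⟨ Σ-cong M (λ i _ → cong (U M (suc i) *_) (cong₂ _*_ (gcd-k-a a₁ m₁∣M (suc i)) (gcd-k-a a₂ m₂∣M (suc i)))) ⟩
    Σ< M (term ∘ suc)
      ≡⟨ Σ-rotate M term term-periodic ⟩
    Σ< M term ∎
    where
    term : ℕ → ℕ
    term k = U M k * (gcd (k + s a₁) m₁ * gcd (k + s a₂) m₂)
    term-periodic : term M ≡ term 0
    term-periodic = cong₂ _*_ (U-period M)
      (cong₂ _*_ (gcd-translate (s a₁) m₁∣M) (gcd-translate (s a₂) m₂∣M))

-- Divisors of prime powers p^u and the admissible pairs among them.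
module PrimePower (p : ℕ) (p-prime : Prime p) where
  private
    instance
      p≢0 : NonZero p
      p≢0 = >-nonZero (<-trans z<s (prime>1 p-prime))

  p^u>0 : ∀ u → 0 < p ^ u
  p^u>0 = m^n>0 p

  divisor-of-power : ∀ u {d} → d ∣ p ^ u → d ≡ 1 ⊎ p ∣ d
  divisor-of-power u {d} d∣p^u with p ∣? d
  ... | yes p∣d = inj₂ p∣d
  ... | no  p∤d = inj₁ (coprime-power u (coprime-prime⇐ p-prime p∤d) (∣-refl , d∣p^u))
    where
    coprime-power : ∀ u → Coprime d p → Coprime d (p ^ u)
    coprime-power zero    _   = Cop.sym (Cop.1-coprimeTo d)
    coprime-power (suc u) d⊥p = coprime-*⇐ {d} {p} d⊥p (coprime-power u d⊥p)

  divisor-step : ∀ u {d} → d ∣ p ^ suc u → d ∣ p ^ u ⊎ d ≡ p ^ suc u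
  divisor-step zero {d} d∣p with prime⇒irreducible p-prime (subst (d ∣_) (*-identityʳ p) d∣p)
  ... | inj₁ refl = inj₁ ∣-refl
  ... | inj₂ refl = inj₂ (sym (*-identityʳ p))
  divisor-step (suc u) {d} d∣ with p ∣? d
  ... | no  p∤d = inj₁ (coprime-divisor (coprime-prime⇐ p-prime p∤d) d∣)
  ... | yes (divides e refl) with divisor-step u {e} (*-cancelˡ-∣ p (subst (_∣ p * p ^ suc u) (*-comm e p) d∣))
  ...   | inj₁ e∣ = inj₁ (subst (e * p ∣_) (*-comm (p ^ u) p) (*-monoˡ-∣ p e∣))
  ...   | inj₂ refl = inj₂ (*-comm (p ^ suc u) p)

  divisor-count : ∀ u → Σ∣ (p ^ u) (λ _ → 1) ≡ suc u
  divisor-count zero    = refl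
  divisor-count (suc u) = begin
    Σ< P′ (λ i → 𝟙 (suc i ∣? P′) * 1)
      ≡⟨ Σ-cong P′ (λ i _ → split (suc i)) ⟩
    Σ< P′ (λ i → 𝟙 (suc i ∣? P) * 1 + 𝟙 (suc i ≟ P′))
      ≡⟨ Σ-+ P′ _ _ ⟩
    Σ< P′ (λ i → 𝟙 (suc i ∣? P) * 1) + Σ< P′ (λ i → 𝟙 (suc i ≟ P′))
      ≡⟨ cong₂ _+_ (trans (Σ-extend P P′ _ (<⇒≤ P<P′) beyond-P) (divisor-count u)) top ⟩
    suc u + 1
      ≡⟨ +-comm (suc u) 1 ⟩
    suc (suc u) ∎
    where
    P : ℕ
    P = p ^ u
    P′ : ℕ
    P′ = p ^ suc u
    P<P′ : P < P′
    P<P′ = subst (P <_) (*-comm P p) (m<m*n P p {{>-nonZero (p^u>0 u)}} (prime>1 p-prime))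
    split : ∀ d → 𝟙 (d ∣? P′) * 1 ≡ 𝟙 (d ∣? P) * 1 + 𝟙 (d ≟ P′)
    split d = trans (*-identityʳ _) (trans
      (𝟙-⊎ (divisor-step u) (λ d∣P → ∣-trans d∣P (∣n⇒∣m*n p ∣-refl)) (λ { refl → ∣-refl })
           (λ { d∣P refl → <⇒≱ P<P′ (∣⇒≤ {{>-nonZero (p^u>0 u)}} d∣P) })
           (d ∣? P′) (d ∣? P) (d ≟ P′))
      (cong (_+ 𝟙 (d ≟ P′)) (sym (*-identityʳ _))))
    beyond-P : ∀ i → P ≤ i → i < P′ → 𝟙 (suc i ∣? P) * 1 ≡ 0
    beyond-P i P≤i _ = cong (_* 1) (𝟙-no (suc i ∣? P) (λ h → <⇒≱ (s≤s P≤i) (∣⇒≤ {{>-nonZero (p^u>0 u)}} h)))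
    top : Σ< P′ (λ i → 𝟙 (suc i ≟ P′)) ≡ 1
    top = count≡1 (λ i → suc i ≟ P′) P′ (λ i j _ _ hi hj → suc-injective (trans hi (sym hj)))
      (P′ ∸ 1) (∸-monoʳ-< z<s (p^u>0 (suc u))) (m+[n∸m]≡n {1} (p^u>0 (suc u)))

  coprimeDivisors : ℕ → ℕ → ℕ
  coprimeDivisors u c = Σ∣ (p ^ u) (λ d → 𝟙 (coprime? d c))

  divisor-1 : ∀ u c → 𝟙 (1 ∣? p ^ u) * 𝟙 (coprime? 1 c) ≡ 1
  divisor-1 u c = cong₂ _*_ (𝟙-yes (1 ∣? p ^ u) (1∣ _)) (𝟙-yes (coprime? 1 c) (Cop.1-coprimeTo c))

  coprimeDivisors-∤ : ∀ u c → ¬ p ∣ c → coprimeDivisors u c ≡ suc u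
  coprimeDivisors-∤ u c p∤c = trans (Σ∣-cong (p ^ u) all-coprime) (divisor-count u)
    where
    all-coprime : ∀ d .{{_ : NonZero d}} → d ∣ p ^ u → 𝟙 (coprime? d c) ≡ 1
    all-coprime d d∣ = 𝟙-yes (coprime? d c) d⊥c
      where
      d⊥c : Coprime d c
      d⊥c (e∣d , e∣c) with divisor-of-power u (∣-trans e∣d d∣)
      ... | inj₁ e≡1 = e≡1
      ... | inj₂ p∣e = contradiction (∣-trans p∣e e∣c) p∤c

  shares-p : ∀ u {d c} → d ∣ p ^ u → d ≢ 1 → p ∣ c → ¬ Coprime d c
  shares-p u d∣ d≢1 p∣c d⊥c with divisor-of-power u d∣
  ... | inj₁ d≡1 = d≢1 d≡1
  ... | inj₂ p∣d = <⇒≢ (prime>1 p-prime) (sym (d⊥c (p∣d , p∣c)))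

  coprimeDivisors-∣ : ∀ u c → p ∣ c → coprimeDivisors u c ≡ 1
  coprimeDivisors-∣ u c p∣c = trans
    (Σ-head (p ^ u) _ (p^u>0 u) (λ r _ → others r (suc (suc r) ∣? (p ^ u))))
    (divisor-1 u c)
    where
    others : ∀ r (x : Dec (suc (suc r) ∣ p ^ u)) → 𝟙 x * 𝟙 (coprime? (suc (suc r)) c) ≡ 0
    others r (yes d∣) = cong (_+ 0) (𝟙-no (coprime? (suc (suc r)) c) (shares-p u d∣ (λ ()) p∣c))
    others r (no _)   = refl

  -- The row of a proper divisor d₁ of p^u: since p ∣ d₁, the only admissible partner
  -- d₂ ∣ p^v is d₂ = 1.
  proper-row : ∀ c₁ c₂ u v {d₁} → d₁ ∣ p ^ u → p ∣ d₁ →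
               Σ∣ (p ^ v) (admissible c₁ c₂ d₁) ≡ 𝟙 (coprime? d₁ c₁)
  proper-row c₁ c₂ u v {d₁} d₁∣ p∣d₁ = begin
    Σ∣ (p ^ v) (admissible c₁ c₂ d₁)        ≡⟨ Σ-head (p ^ v) _ (p^u>0 v) (λ r _ → excluded r (2 + r ∣? p ^ v)) ⟩
    𝟙 (1 ∣? p ^ v) * admissible c₁ c₂ d₁ 1  ≡⟨ cong (_* admissible c₁ c₂ d₁ 1) (𝟙-yes (1 ∣? p ^ v) (1∣ _)) ⟩
    1 * admissible c₁ c₂ d₁ 1               ≡⟨ *-identityˡ _ ⟩
    admissible c₁ c₂ d₁ 1                   ≡⟨ admissible-1ʳ c₁ c₂ d₁ ⟩
    𝟙 (coprime? d₁ c₁)                      ∎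
    where
    excluded : ∀ r (y : Dec (2 + r ∣ p ^ v)) → 𝟙 y * admissible c₁ c₂ d₁ (2 + r) ≡ 0
    excluded r (no _)    = refl
    excluded r (yes d₂∣) with divisor-of-power v d₂∣
    ... | inj₁ ()
    ... | inj₂ p∣d₂ = cong (_+ 0) (admissible-common c₁ c₂ (prime>1 p-prime) p∣d₁ p∣d₂)

  -- Admissible pairs of divisors of p^u, p^v: since coprime divisors cannot both be
  -- proper, they are the pairs (1, d₂) and (d₁, 1), with (1, 1) counted twice.
  admissible-pairs : ∀ c₁ c₂ u v →
    Σ∣ (p ^ u) (λ d₁ → Σ∣ (p ^ v) (admissible c₁ c₂ d₁)) + 1 ≡ coprimeDivisors v c₂ + coprimeDivisors u c₁
  admissible-pairs c₁ c₂ u v = begin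
    Σ∣ (p ^ u) row + 1
      ≡⟨ cong (_+ 1) (Σ-uncons (p ^ u) _ (p^u>0 u)) ⟩
    𝟙 (1 ∣? p ^ u) * row 1 + Σ< (p ^ u ∸ 1) (λ i → 𝟙 (2 + i ∣? p ^ u) * row (2 + i)) + 1
      ≡⟨ cong (_+ 1) (cong₂ _+_ first-row (Σ-cong (p ^ u ∸ 1) (λ i _ → later-row i (2 + i ∣? p ^ u)))) ⟩
    coprimeDivisors v c₂ + rest + 1
      ≡⟨ +-assoc (coprimeDivisors v c₂) rest 1 ⟩
    coprimeDivisors v c₂ + (rest + 1)
      ≡⟨ cong (coprimeDivisors v c₂ +_) (trans (+-comm rest 1) (sym (trans
           (Σ-uncons (p ^ u) _ (p^u>0 u)) (cong (_+ rest) (divisor-1 u c₁))))) ⟩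
    coprimeDivisors v c₂ + coprimeDivisors u c₁ ∎
    where
    row : ℕ → ℕ
    row d₁ = Σ∣ (p ^ v) (admissible c₁ c₂ d₁)
    rest : ℕ
    rest = Σ< (p ^ u ∸ 1) (λ i → 𝟙 (2 + i ∣? p ^ u) * 𝟙 (coprime? (2 + i) c₁))
    first-row : 𝟙 (1 ∣? p ^ u) * row 1 ≡ coprimeDivisors v c₂
    first-row = trans (cong (_* row 1) (𝟙-yes (1 ∣? p ^ u) (1∣ _)))
                      (trans (*-identityˡ (row 1)) (Σ∣-cong (p ^ v) (λ d _ → admissible-1ˡ c₁ c₂ d)))
    later-row : ∀ i (x : Dec (2 + i ∣ p ^ u)) → 𝟙 x * row (2 + i) ≡ 𝟙 x * 𝟙 (coprime? (2 + i) c₁)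
    later-row i (no _)    = refl
    later-row i (yes d₁∣) with divisor-of-power u d₁∣
    ... | inj₁ ()
    ... | inj₂ p∣d₁ = cong (_+ 0) (proper-row c₁ c₂ u v d₁∣ p∣d₁)

R-formula : ∀ (a₁ a₂ : ℤ) → ℤ.∣ a₁ ℤ.- a₂ ∣ ≡ 1 → ∀ m₁ m₂ M → m₁ ≥ 1 → m₂ ≥ 1 → M ≥ 1 →
            lcm m₁ m₂ ∣ M → RSum a₁ a₂ m₁ m₂ M ≡ φ M * pairCount a₁ a₂ m₁ m₂
R-formula a₁ a₂ gap m₁ m₂ M m₁>0 m₂>0 M>0 lcm∣M = begin
  RSum a₁ a₂ m₁ m₂ M
    ≡⟨ RSum≡Σ a₁ a₂ m₁∣M m₂∣M ⟩
  Σ< M (λ k → U M k * (gcd (k + s a₁) m₁ * gcd (k + s a₂) m₂))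
    ≡⟨ core m₁ m₂ m₁>0 m₂>0 m₁∣M m₂∣M ⟩
  totient M * Σ∣ m₁ (λ d₁ → Σ∣ m₂ (admissible (s a₁) (s a₂) d₁))
    ≡⟨ cong₂ _*_ (sym (φ≡totient M)) (Σ∣-cong m₁ (λ d₁ d₁∣m₁ → Σ∣-cong m₂ (λ d₂ d₂∣m₂ →
         sym (admissible-shift a₁ a₂ (∣-trans d₁∣m₁ m₁∣M) (∣-trans d₂∣m₂ m₂∣M))))) ⟩
  φ M * Σ∣ m₁ (λ d₁ → Σ∣ m₂ (admissible ℤ.∣ a₁ ∣ ℤ.∣ a₂ ∣ d₁))
    ≡⟨ cong (φ M *_) (sym (pairCount≡Σ∣ a₁ a₂ m₁ m₂)) ⟩
  φ M * pairCount a₁ a₂ m₁ m₂ ∎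
  where
  instance
    M≢0 : NonZero M
    M≢0 = >-nonZero M>0
  open Shift M
  open Core M (s a₁) (s a₂) (separated a₁ a₂ gap)
  m₁∣M : m₁ ∣ M
  m₁∣M = ∣-trans (m∣lcm[m,n] m₁ m₂) lcm∣M
  m₂∣M : m₂ ∣ M
  m₂∣M = ∣-trans (n∣lcm[m,n] m₁ m₂) lcm∣M

R-prime-power : ∀ (a₁ a₂ : ℤ) → ℤ.∣ a₁ ℤ.- a₂ ∣ ≡ 1 → ∀ p u v M (p-prime : Prime p) → M ≥ 1 →
  lcm (p ^ u) (p ^ v) ∣ M → ∀ n →
  PrimePower.coprimeDivisors p p-prime v ℤ.∣ a₂ ∣ + PrimePower.coprimeDivisors p p-prime u ℤ.∣ a₁ ∣ ≡ n + 1 →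
  RSum a₁ a₂ (p ^ u) (p ^ v) M ≡ φ M * n
R-prime-power a₁ a₂ gap p u v M p-prime M>0 lcm∣M n counts =
  trans (R-formula a₁ a₂ gap (p ^ u) (p ^ v) M (p^u>0 u) (p^u>0 v) M>0 lcm∣M)
        (cong (φ M *_) (trans (pairCount≡Σ∣ a₁ a₂ (p ^ u) (p ^ v))
                              (+-cancelʳ-≡ 1 _ _ (trans (admissible-pairs ℤ.∣ a₁ ∣ ℤ.∣ a₂ ∣ u v) counts))))
  where open PrimePower p p-prime

common-divisor-unit : ∀ (a₁ a₂ : ℤ) → ℤ.∣ a₁ ℤ.- a₂ ∣ ≡ 1 → ∀ {d} → ℤ.+ d ℤD.∣ a₁ → ℤ.+ d ℤD.∣ a₂ → d ≡ 1
common-divisor-unit a₁ a₂ gap {d} d∣a₁ d∣a₂ =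
  gap-unit a₁ a₂ gap (ℤS.∣m∣n⇒∣m-n (ℤS.∣ᵤ⇒∣ {ℤ.+ d} {a₁} d∣a₁) (ℤS.∣ᵤ⇒∣ {ℤ.+ d} {a₂} d∣a₂))

open import Data.Integer using (+_; ∣_∣)

R-prime-power-values : (a₁ a₂ : ℤ) → ∣ a₁ ℤ.- a₂ ∣ ≡ 1 →
  (p u v M : ℕ) → Prime p → u ≥ 1 → v ≥ 1 → M ≥ 1 → lcm (p ^ u) (p ^ v) ∣ M →
    ((¬ (+ p ℤD.∣ a₁) → ¬ (+ p ℤD.∣ a₂) → RSum a₁ a₂ (p ^ u) (p ^ v) M ≡ φ M * (u + v + 1))
    × (¬ (+ p ℤD.∣ a₁) → (+ p ℤD.∣ a₂) → RSum a₁ a₂ (p ^ u) (p ^ v) M ≡ φ M * (u + 1))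
    × ((+ p ℤD.∣ a₁) → ¬ (+ p ℤD.∣ a₂) → RSum a₁ a₂ (p ^ u) (p ^ v) M ≡ φ M * (v + 1))
    × ((+ p ℤD.∣ a₁) → (+ p ℤD.∣ a₂) → RSum a₁ a₂ (p ^ u) (p ^ v) M ≡ φ M * 1))
R-prime-power-values a₁ a₂ gap p u v M p-prime _ _ M>0 lcm∣M =
    (λ p∤a₁ p∤a₂ → R (u + v + 1) (trans (cong₂ _+_ (coprimeDivisors-∤ v _ p∤a₂) (coprimeDivisors-∤ u _ p∤a₁)) (both-coprime u v)))
  , (λ p∤a₁ p∣a₂ → R (u + 1)     (trans (cong₂ _+_ (coprimeDivisors-∣ v _ p∣a₂) (coprimeDivisors-∤ u _ p∤a₁)) (first-coprime u)))
  , (λ p∣a₁ p∤a₂ → R (v + 1)     (trans (cong₂ _+_ (coprimeDivisors-∤ v _ p∤a₂) (coprimeDivisors-∣ u _ p∣a₁)) (second-coprime v)))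
  , (λ p∣a₁ p∣a₂ → contradiction (common-divisor-unit a₁ a₂ gap p∣a₁ p∣a₂) (>⇒≢ (prime>1 p-prime)))
  where
  open PrimePower p p-prime
  R : ∀ n → coprimeDivisors v (∣ a₂ ∣) + coprimeDivisors u (∣ a₁ ∣) ≡ n + 1 → RSum a₁ a₂ (p ^ u) (p ^ v) M ≡ φ M * n
  R = R-prime-power a₁ a₂ gap p u v M p-prime M>0 lcm∣M
  both-coprime : ∀ u v → suc v + suc u ≡ u + v + 1 + 1
  both-coprime = solve-∀
  first-coprime : ∀ u → 1 + suc u ≡ u + 1 + 1
  first-coprime = solve-∀
  second-coprime : ∀ v → suc v + 1 ≡ v + 1 + 1
  second-coprime = solve-∀

corollary10 : (a₁ a₂ : ℤ) → ∣ a₁ ℤ.- a₂ ∣ ≡ 1 →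
  ((m₁ m₂ M : ℕ) → m₁ ≥ 1 → m₂ ≥ 1 → M ≥ 1 → lcm m₁ m₂ ∣ M →
    RSum a₁ a₂ m₁ m₂ M ≡ φ M * pairCount a₁ a₂ m₁ m₂)
  ×
  ((p u v M : ℕ) → Prime p → u ≥ 1 → v ≥ 1 → M ≥ 1 → lcm (p ^ u) (p ^ v) ∣ M →
    ((¬ (+ p ℤD.∣ a₁) → ¬ (+ p ℤD.∣ a₂) → RSum a₁ a₂ (p ^ u) (p ^ v) M ≡ φ M * (u + v + 1))
    × (¬ (+ p ℤD.∣ a₁) → (+ p ℤD.∣ a₂) → RSum a₁ a₂ (p ^ u) (p ^ v) M ≡ φ M * (u + 1))
    × ((+ p ℤD.∣ a₁) → ¬ (+ p ℤD.∣ a₂) → RSum a₁ a₂ (p ^ u) (p ^ v) M ≡ φ M * (v + 1))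
    × ((+ p ℤD.∣ a₁) → (+ p ℤD.∣ a₂) → RSum a₁ a₂ (p ^ u) (p ^ v) M ≡ φ M * 1)))
corollary10 a₁ a₂ gap = R-formula a₁ a₂ gap , R-prime-power-values a₁ a₂ gap
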